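{- For every admissible word $w\in W^0$ we have $f(w)=f(\tau(w))$.
   Context: $W$ is the set of finite words in the six formal letters $e_{AB},e_{AC},e_{AD},e_{BC},e_{BD},e_{CD}$; a letter $e_{uv}$ has first entry $u$ and second entry $v$. A word is admissible if it does not begin with $e_{AB},e_{AC},e_{AD}$ and does not end with $e_{AD},e_{BD},e_{CD}$; $W^0$ is the set of admissible words. $\tau:W\to W$ is the anti-automorphism with $\tau(e_{AB})=e_{CD}$, $\tau(e_{AC})=e_{BD}$, $\tau(e_{AD})=e_{AD}$, $\tau(e_{BC})=e_{BC}$, $\tau(e_{BD})=e_{AC}$, $\tau(e_{CD})=e_{AB}$ (it preserves admissibility). For $w=e_{u_1v_1}\cdots e_{u_kv_k}\in W^0$ set $d_j:=\#\{h\geq j\mid u_hv_h\in\{AB,AC,BC\}\}$ (admissibility gives $d_j\geq1$) and \[ f(w):=\sum_{n_1\geq n_2\geq\cdots\geq n_k\geq0}\prod_{j=1}^k\bigl(\varphi_j(u_j)-\varphi_j(v_j)\bigr)\in\mathbb{Q}[[q]], \] where $\varphi_j(A)=1$, $\varphi_j(B)=\varphi_j(C)=0$, $\varphi_j(D)=\dfrac{q^{n_j}}{q^{n_j}-q^{ -d_j}}=-\dfrac{q^{n_j+d_j}}{1-q^{n_j+d_j}}$ (the series converges $q$-adically; $f(\text{empty word})=1$). This is the specialization $A=0$, $B=C=\infty$, $D=1$ of the paper's functional $L_q$. -}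

module Defs where

open import Data.Nat as ℕ using (ℕ; zero; suc; _∸_; _≤_)
open import Data.Nat.Divisibility using (_∣?_)
open import Data.Rational using (ℚ; 0ℚ; 1ℚ; _+_; _*_; -_; _-_)
open import Data.List using (List; []; _∷_; reverse; map)
open import Data.Product using (∃; _×_)
open import Data.Unit using (⊤)
open import Data.Empty using (⊥)
open import Relation.Nullary using (yes; no)
open import Relation.Binary.PropositionalEquality using (_≡_)

-- Formal power series ℚ[[q]] as coefficient functions

Series : Set
Series = ℕ → ℚ

sumUpTo : ℕ → (ℕ → ℚ) → ℚ
sumUpTo zero    f = f 0
sumUpTo (suc n) f = sumUpTo n f + f (suc n)

constS : ℚ → Series
constS c zero    = c
constS c (suc _) = 0ℚ

_+ˢ_ : Series → Series → Series
(f +ˢ g) i = f i + g i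

_-ˢ_ : Series → Series → Series
(f -ˢ g) i = f i - g i

-ˢ_ : Series → Series
(-ˢ f) i = - f i

_*ˢ_ : Series → Series → Series
(f *ˢ g) n = sumUpTo n (λ i → f i * g (n ∸ i))

sumSeries : ℕ → (ℕ → Series) → Series
sumSeries zero    F = F 0
sumSeries (suc M) F = sumSeries M F +ˢ F (suc M)

-- q^e / (1 - q^e) = Σ_{t ≥ 1} q^{t e}   (used only for e ≥ 1)
qPowOverOneMinus : ℕ → Series
qPowOverOneMinus e zero = 0ℚ
qPowOverOneMinus e (suc i) with e ∣? suc i
... | yes _ = 1ℚ
... | no  _ = 0ℚ

data Vertex : Set where
  A B C D : Vertex

data Letter : Set where
  eAB eAC eAD eBC eBD eCD : Letter

first : Letter → Vertex
first eAB = A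
first eAC = A
first eAD = A
first eBC = B
first eBD = B
first eCD = C

second : Letter → Vertex
second eAB = B
second eAC = C
second eAD = D
second eBC = C
second eBD = D
second eCD = D

Word : Set
Word = List Letter

BadFirst : Letter → Set
BadFirst eAB = ⊤
BadFirst eAC = ⊤
BadFirst eAD = ⊤
BadFirst eBC = ⊥
BadFirst eBD = ⊥
BadFirst eCD = ⊥

BadLast : Letter → Set
BadLast eAB = ⊥
BadLast eAC = ⊥
BadLast eAD = ⊤
BadLast eBC = ⊥
BadLast eBD = ⊤
BadLast eCD = ⊤

FirstOK : Word → Set
FirstOK []      = ⊤
FirstOK (x ∷ _) = BadFirst x → ⊥

LastOK : Word → Set
LastOK []           = ⊤
LastOK (x ∷ [])     = BadLast x → ⊥
LastOK (_ ∷ y ∷ ys) = LastOK (y ∷ ys)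

Admissible : Word → Set
Admissible w = FirstOK w × LastOK w

τL : Letter → Letter
τL eAB = eCD
τL eAC = eBD
τL eAD = eAD
τL eBC = eBC
τL eBD = eAC
τL eCD = eAB

τ : Word → Word
τ w = reverse (map τL w)

-- The functional f (specialisation A=0, B=C=∞, D=1 of L_q)

isABC : Letter → ℕ
isABC eAB = 1
isABC eAC = 1
isABC eBC = 1
isABC eAD = 0
isABC eBD = 0
isABC eCD = 0

dCount : Word → ℕ
dCount []       = 0
dCount (x ∷ xs) = isABC x ℕ.+ dCount xs

-- φ_j(v) as a power series, with n = n_j and d = d_j
φ : ℕ → ℕ → Vertex → Series
φ n d A = constS 1ℚ
φ n d B = constS 0ℚ
φ n d C = constS 0ℚ
φ n d D = -ˢ qPowOverOneMinus (n ℕ.+ d)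

factor : Letter → ℕ → ℕ → Series
factor x n d = φ n d (first x) -ˢ φ n d (second x)

-- partialSum w M = Σ over M ≥ n_1 ≥ n_2 ≥ ... ≥ n_k ≥ 0 of the product
partialSum : Word → ℕ → Series
partialSum []       M = constS 1ℚ
partialSum (x ∷ xs) M =
  sumSeries M (λ n → factor x n (dCount (x ∷ xs)) *ˢ partialSum xs n)

-- q-adic convergence: the defining series of f(w) sums to S
SumsTo : Word → Series → Set
SumsTo w S = (N : ℕ) → ∃ λ M → (M' : ℕ) → M ≤ M' →
  (i : ℕ) → i ≤ N → partialSum w M' i ≡ S i

-- Modulo q^(L+1) only the levels y = n + d ≤ L matter, and f(w) becomes the entry sum of the row
-- vector e₀ N(x_k) ⋯ N(x₁) of (L+1)×(L+1) transfer matrices N; for τ(w) the same matrices occur in the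
-- opposite order with AB, AC and BD, CD exchanged.  The geometric series Dq e q^(e t) = Σ_{j ≥ t} q^(e j)
-- and the recursion of q-Pochhammer symbols give intertwining relations M Q = Q Nᵀ and M K = K N∘dual
-- for a second family M, the matrix Q = (q^(n m)) and a connector K whose n-th row sum (q^(L+1-n); q)_n
-- is 1 modulo q^(L+1-n), while the n-th entry of e₀ M(x₁) ⋯ M(x_k) is divisible by q^n.  Pushing the
-- letters of w through Q and then back through K turns the sum for w into the sum for τ(w).  The
-- relations fail only at the boundary index 0, which admissibility keeps out; admissibility also makes
-- the partial sums stabilise, because the first letter then carries the factor q^(n₁+d₁) / (1 - q^(n₁+d₁)).

module Submission where

open import Defs
open import Algebra using (CommutativeRing; IsCommutativeRing)
open import Algebra.Solver.Ring.AlmostCommutativeRing using (_-Raw-AlmostCommutative⟶_; fromCommutativeRing)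
open import Data.Empty using (⊥-elim)
open import Data.List using (List; []; _∷_; _++_; [_]; foldl; reverse; map)
import Data.List.Properties as LP
open import Data.List.Reverse using (reverseView; []; _∶_∶ʳ_)
open import Data.Maybe using (Maybe; just; nothing)
open import Data.Nat as ℕ using (ℕ; zero; suc; _∸_; _≤_; _<_; z≤n; s≤s)
import Data.Nat.Properties as ℕP
open import Data.Product using (∃; _×_; _,_; proj₁; proj₂)
open import Data.Rational as ℚ using (0ℚ; 1ℚ)
import Data.Rational.Properties as ℚP
open import Data.Unit using (tt)
open import Function using (_∘_)
open import Level using (0ℓ)
open import Relation.Binary.Definitions using (tri<; tri≈; tri>)
open import Relation.Binary.PropositionalEquality as P using (_≡_; _≢_)
open import Relation.Nullary using (Dec; yes; no; ¬_)

module FiniteSums {c ℓ} (R : CommutativeRing c ℓ) where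
  open CommutativeRing R
  open import Relation.Binary.Reasoning.Setoid setoid

  Σ≤ : ℕ → (ℕ → Carrier) → Carrier
  Σ≤ zero    f = f 0
  Σ≤ (suc n) f = Σ≤ n f + f (suc n)

  𝟙[_] : ∀ {p} {A : Set p} → Dec A → Carrier
  𝟙[ yes _ ] = 1#
  𝟙[ no  _ ] = 0#

  module _ {p} {A : Set p} where

    𝟙-yes : (a : Dec A) → A → 𝟙[ a ] ≈ 1#
    𝟙-yes (yes _) _  = refl
    𝟙-yes (no ¬x) x = ⊥-elim (¬x x)

    𝟙-no : (a : Dec A) → ¬ A → 𝟙[ a ] ≈ 0#
    𝟙-no (yes x) ¬x = ⊥-elim (¬x x)
    𝟙-no (no _)  _  = refl

    𝟙-⇔ : ∀ {q} {B : Set q} (a : Dec A) (b : Dec B) → (A → B) → (B → A) → 𝟙[ a ] ≈ 𝟙[ b ]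
    𝟙-⇔ (yes _) (yes _) _ _ = refl
    𝟙-⇔ (yes x) (no ¬y) f _ = ⊥-elim (¬y (f x))
    𝟙-⇔ (no ¬x) (yes y) _ g = ⊥-elim (¬x (g y))
    𝟙-⇔ (no _)  (no _)  _ _ = refl

  Σ-cong : ∀ n {f g : ℕ → Carrier} → (∀ i → i ≤ n → f i ≈ g i) → Σ≤ n f ≈ Σ≤ n g
  Σ-cong zero    f≈g = f≈g 0 z≤n
  Σ-cong (suc n) f≈g =
    +-cong (Σ-cong n (λ i i≤n → f≈g i (ℕP.m≤n⇒m≤1+n i≤n))) (f≈g (suc n) ℕP.≤-refl)

  Σ-zero : ∀ n {f : ℕ → Carrier} → (∀ i → i ≤ n → f i ≈ 0#) → Σ≤ n f ≈ 0#
  Σ-zero zero    f≈0 = f≈0 0 z≤n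
  Σ-zero (suc n) f≈0 = begin
    Σ≤ n _ + _ ≈⟨ +-cong (Σ-zero n (λ i i≤n → f≈0 i (ℕP.m≤n⇒m≤1+n i≤n))) (f≈0 (suc n) ℕP.≤-refl) ⟩
    0# + 0#    ≈⟨ +-identityˡ 0# ⟩
    0#         ∎

  Σ-distrib-+ : ∀ n (f g : ℕ → Carrier) → Σ≤ n (λ i → f i + g i) ≈ Σ≤ n f + Σ≤ n g
  Σ-distrib-+ zero    f g = refl
  Σ-distrib-+ (suc n) f g = begin
    Σ≤ n (λ i → f i + g i) + (f (suc n) + g (suc n)) ≈⟨ +-cong (Σ-distrib-+ n f g) refl ⟩
    (Σ≤ n f + Σ≤ n g) + (f (suc n) + g (suc n))      ≈⟨ +-assoc _ _ _ ⟩
    Σ≤ n f + (Σ≤ n g + (f (suc n) + g (suc n)))      ≈⟨ +-cong refl (x+[y+z]≈y+[x+z] _ _ _) ⟩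
    Σ≤ n f + (f (suc n) + (Σ≤ n g + g (suc n)))      ≈⟨ +-assoc _ _ _ ⟨
    (Σ≤ n f + f (suc n)) + (Σ≤ n g + g (suc n))      ∎
    where
    x+[y+z]≈y+[x+z] : ∀ x y z → x + (y + z) ≈ y + (x + z)
    x+[y+z]≈y+[x+z] x y z = begin
      x + (y + z) ≈⟨ +-assoc x y z ⟨
      (x + y) + z ≈⟨ +-cong (+-comm x y) refl ⟩
      (y + x) + z ≈⟨ +-assoc y x z ⟩
      y + (x + z) ∎

  *-distribˡ-Σ : ∀ n a (f : ℕ → Carrier) → a * Σ≤ n f ≈ Σ≤ n (λ i → a * f i)
  *-distribˡ-Σ zero    a f = refl
  *-distribˡ-Σ (suc n) a f = trans (distribˡ a (Σ≤ n f) (f (suc n))) (+-cong (*-distribˡ-Σ n a f) refl)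

  *-distribʳ-Σ : ∀ n a (f : ℕ → Carrier) → Σ≤ n f * a ≈ Σ≤ n (λ i → f i * a)
  *-distribʳ-Σ zero    a f = refl
  *-distribʳ-Σ (suc n) a f = trans (distribʳ a (Σ≤ n f) (f (suc n))) (+-cong (*-distribʳ-Σ n a f) refl)

  Σ-swap : ∀ n m (F : ℕ → ℕ → Carrier) → Σ≤ n (λ i → Σ≤ m (F i)) ≈ Σ≤ m (λ j → Σ≤ n (λ i → F i j))
  Σ-swap zero    m F = refl
  Σ-swap (suc n) m F = begin
    Σ≤ n (λ i → Σ≤ m (F i)) + Σ≤ m (F (suc n))         ≈⟨ +-cong (Σ-swap n m F) refl ⟩
    Σ≤ m (λ j → Σ≤ n (λ i → F i j)) + Σ≤ m (F (suc n)) ≈⟨ Σ-distrib-+ m _ _ ⟨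
    Σ≤ m (λ j → Σ≤ n (λ i → F i j) + F (suc n) j)      ∎

  Σ-single : ∀ n k {f : ℕ → Carrier} → k ≤ n → (∀ i → i ≤ n → i ≢ k → f i ≈ 0#) → Σ≤ n f ≈ f k
  Σ-single zero    zero    _   _   = refl
  Σ-single (suc n) k {f} k≤1+n off with k ℕP.≟ suc n
  ... | yes P.refl = begin
    Σ≤ n f + f (suc n) ≈⟨ +-cong (Σ-zero n (λ i i≤n → off i (ℕP.m≤n⇒m≤1+n i≤n) (ℕP.<⇒≢ (s≤s i≤n)))) refl ⟩
    0# + f (suc n)     ≈⟨ +-identityˡ _ ⟩
    f (suc n)          ∎
  ... | no k≢1+n = begin
    Σ≤ n f + f (suc n) ≈⟨ +-cong (Σ-single n k (ℕP.≤-pred (ℕP.≤∧≢⇒< k≤1+n k≢1+n)) (λ i i≤n → off i (ℕP.m≤n⇒m≤1+n i≤n)))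
                                  (off (suc n) ℕP.≤-refl (k≢1+n ∘ P.sym)) ⟩
    f k + 0#           ≈⟨ +-identityʳ _ ⟩
    f k                ∎

  Σ-suc : ∀ n (f : ℕ → Carrier) → Σ≤ (suc n) f ≈ f 0 + Σ≤ n (λ i → f (suc i))
  Σ-suc zero    f = refl
  Σ-suc (suc n) f = trans (+-cong (Σ-suc n f) refl) (+-assoc _ _ _)

  Σ-reverse : ∀ n (f : ℕ → Carrier) → Σ≤ n f ≈ Σ≤ n (λ i → f (n ∸ i))
  Σ-reverse zero    f = refl
  Σ-reverse (suc n) f = begin
    Σ≤ n f + f (suc n)                 ≈⟨ +-comm _ _ ⟩
    f (suc n) + Σ≤ n f                 ≈⟨ +-cong refl (Σ-reverse n f) ⟩
    f (suc n) + Σ≤ n (λ i → f (n ∸ i)) ≈⟨ Σ-suc n (λ i → f (suc n ∸ i)) ⟨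
    Σ≤ (suc n) (λ i → f (suc n ∸ i))   ∎

  Σ-triangle : ∀ n (F : ℕ → ℕ → Carrier) →
               Σ≤ n (λ i → Σ≤ i (F i)) ≈ Σ≤ n (λ j → Σ≤ (n ∸ j) (λ k → F (j ℕ.+ k) j))
  Σ-triangle zero    F = refl
  Σ-triangle (suc n) F = begin
    Σ≤ n (λ i → Σ≤ i (F i)) + (Σ≤ n (F (suc n)) + F (suc n) (suc n))
      ≈⟨ +-cong (Σ-triangle n F) refl ⟩
    Σ≤ n (λ j → Σ≤ (n ∸ j) (λ k → F (j ℕ.+ k) j)) + (Σ≤ n (F (suc n)) + F (suc n) (suc n))
      ≈⟨ +-assoc _ _ _ ⟨
    (Σ≤ n (λ j → Σ≤ (n ∸ j) (λ k → F (j ℕ.+ k) j)) + Σ≤ n (F (suc n))) + F (suc n) (suc n)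
      ≈⟨ +-cong (Σ-distrib-+ n _ _) (reflexive (P.cong (λ t → F t (suc n)) (ℕP.+-identityʳ (suc n)))) ⟨
    Σ≤ n (λ j → Σ≤ (n ∸ j) (λ k → F (j ℕ.+ k) j) + F (suc n) j) + F (suc n ℕ.+ 0) (suc n)
      ≈⟨ +-cong (Σ-cong n extend) (reflexive (P.cong (λ t → Σ≤ t (λ k → F (suc n ℕ.+ k) (suc n))) (ℕP.n∸n≡0 (suc n)))) ⟨
    Σ≤ n (λ j → Σ≤ (suc n ∸ j) (λ k → F (j ℕ.+ k) j)) + Σ≤ (suc n ∸ suc n) (λ k → F (suc n ℕ.+ k) (suc n)) ∎
    where
    extend : ∀ j → j ≤ n → Σ≤ (suc n ∸ j) (λ k → F (j ℕ.+ k) j) ≈ Σ≤ (n ∸ j) (λ k → F (j ℕ.+ k) j) + F (suc n) j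
    extend j j≤n rewrite ℕP.+-∸-assoc 1 j≤n =
      +-cong refl (reflexive (P.cong (λ t → F t j) (P.trans (ℕP.+-suc j (n ∸ j)) (P.cong suc (ℕP.m+[n∸m]≡n j≤n)))))

  x-y+[y-z]≈x-z : ∀ x y z → (x - y) + (y - z) ≈ x - z
  x-y+[y-z]≈x-z x y z = begin
    (x - y) + (y - z)   ≈⟨ +-assoc x (- y) (y - z) ⟩
    x + (- y + (y - z)) ≈⟨ +-cong refl (+-assoc (- y) y (- z)) ⟨
    x + ((- y + y) - z) ≈⟨ +-cong refl (+-cong (-‿inverseˡ y) refl) ⟩
    x + (0# - z)        ≈⟨ +-cong refl (+-identityˡ (- z)) ⟩
    x - z               ∎

  Σ-telescope : ∀ n (T : ℕ → Carrier) → Σ≤ n (λ i → T (suc i) - T i) ≈ T (suc n) - T 0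
  Σ-telescope zero    T = refl
  Σ-telescope (suc n) T = begin
    Σ≤ n (λ i → T (suc i) - T i) + (T (suc (suc n)) - T (suc n)) ≈⟨ +-cong (Σ-telescope n T) refl ⟩
    (T (suc n) - T 0) + (T (suc (suc n)) - T (suc n))             ≈⟨ +-comm _ _ ⟩
    (T (suc (suc n)) - T (suc n)) + (T (suc n) - T 0)             ≈⟨ x-y+[y-z]≈x-z _ _ _ ⟩
    T (suc (suc n)) - T 0                                         ∎

  Σ-truncate : ∀ n m {f : ℕ → Carrier} → m ≤ n → (∀ i → m < i → i ≤ n → f i ≈ 0#) → Σ≤ n f ≈ Σ≤ m f
  Σ-truncate n m m≤n off with m ℕP.≟ n
  ... | yes P.refl = refl
  Σ-truncate zero    m m≤n off | no m≢n = ⊥-elim (m≢n (ℕP.n≤0⇒n≡0 m≤n))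
  Σ-truncate (suc n) m {f} m≤1+n off | no m≢1+n = begin
    Σ≤ n f + f (suc n) ≈⟨ +-cong (Σ-truncate n m m≤n (λ i m<i i≤n → off i m<i (ℕP.m≤n⇒m≤1+n i≤n))) (off (suc n) (s≤s m≤n) ℕP.≤-refl) ⟩
    Σ≤ m f + 0#        ≈⟨ +-identityʳ _ ⟩
    Σ≤ m f             ∎
    where
    m≤n : m ≤ n
    m≤n = ℕP.≤-pred (ℕP.≤∧≢⇒< m≤1+n m≢1+n)

  Σ-𝟙≟ : ∀ N n (F : ℕ → Carrier) → n ≤ N → Σ≤ N (λ j → 𝟙[ n ℕP.≟ j ] * F j) ≈ F n
  Σ-𝟙≟ N n F n≤N = begin
    Σ≤ N (λ j → 𝟙[ n ℕP.≟ j ] * F j) ≈⟨ Σ-single N n n≤N (λ i _ i≢n → trans (*-cong (𝟙-no (n ℕP.≟ i) (i≢n ∘ P.sym)) refl) (zeroˡ _)) ⟩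
    𝟙[ n ℕP.≟ n ] * F n              ≈⟨ *-cong (𝟙-yes (n ℕP.≟ n) P.refl) refl ⟩
    1# * F n                         ≈⟨ *-identityˡ (F n) ⟩
    F n                              ∎

  Σ-𝟙≤-telescope : ∀ N t (a : ℕ → Carrier) → t ≤ suc N →
                   Σ≤ N (λ j → 𝟙[ t ℕP.≤? j ] * (a j - a (suc j))) ≈ a t - a (suc N)
  Σ-𝟙≤-telescope zero zero                a _ = *-identityˡ _
  Σ-𝟙≤-telescope zero (suc zero)          a _ = trans (zeroˡ _) (sym (-‿inverseʳ (a 1)))
  Σ-𝟙≤-telescope zero (suc (suc _))       a (s≤s ())
  Σ-𝟙≤-telescope (suc N) t a t≤2+N with t ℕP.≤? suc N
  ... | yes t≤1+N = begin
    Σ≤ N _ + 1# * (a (suc N) - a (suc (suc N)))            ≈⟨ +-cong (Σ-𝟙≤-telescope N t a t≤1+N) (*-identityˡ _) ⟩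
    (a t - a (suc N)) + (a (suc N) - a (suc (suc N)))      ≈⟨ x-y+[y-z]≈x-z _ _ _ ⟩
    a t - a (suc (suc N))                                  ∎
  ... | no t≰1+N rewrite ℕP.≤-antisym t≤2+N (ℕP.≰⇒> t≰1+N) = begin
    Σ≤ N _ + 0# * (a (suc N) - a (suc (suc N))) ≈⟨ +-cong (Σ-zero N vanish) (zeroˡ _) ⟩
    0# + 0#                                     ≈⟨ +-identityˡ 0# ⟩
    0#                                          ≈⟨ -‿inverseʳ _ ⟨
    a (suc (suc N)) - a (suc (suc N))           ∎
    where
    vanish : ∀ j → j ≤ N → 𝟙[ suc (suc N) ℕP.≤? j ] * (a j - a (suc j)) ≈ 0#
    vanish j j≤N = trans (*-cong (𝟙-no (suc (suc N) ℕP.≤? j) (ℕP.<⇒≱ (s≤s (ℕP.m≤n⇒m≤1+n j≤N)))) refl) (zeroˡ _)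

  Σ-pred : ∀ n (f : ℕ → Carrier) → 1 ≤ n → Σ≤ n f ≈ f 0 + Σ≤ (n ∸ 1) (λ i → f (suc i))
  Σ-pred (suc n) f _ = Σ-suc n f

  Σ-shift : ∀ d M (F : ℕ → Carrier) → Σ≤ M (λ n → F (d ℕ.+ n)) ≈ Σ≤ (d ℕ.+ M) (λ y → 𝟙[ d ℕP.≤? y ] * F y)
  Σ-shift zero    M F = Σ-cong M (λ y _ → sym (trans (*-cong (𝟙-yes (0 ℕP.≤? y) z≤n) refl) (*-identityˡ _)))
  Σ-shift (suc d) M F = begin
    Σ≤ M (λ n → F (suc d ℕ.+ n))
      ≈⟨ Σ-shift d M (λ y → F (suc y)) ⟩
    Σ≤ (d ℕ.+ M) (λ y → 𝟙[ d ℕP.≤? y ] * F (suc y))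
      ≈⟨ Σ-cong (d ℕ.+ M) (λ y _ → *-cong (𝟙-⇔ (d ℕP.≤? y) (suc d ℕP.≤? suc y) s≤s ℕP.≤-pred) refl) ⟩
    Σ≤ (d ℕ.+ M) (λ y → 𝟙[ suc d ℕP.≤? suc y ] * F (suc y))
      ≈⟨ +-identityˡ _ ⟨
    0# + Σ≤ (d ℕ.+ M) (λ y → 𝟙[ suc d ℕP.≤? suc y ] * F (suc y))
      ≈⟨ +-cong (trans (*-cong (𝟙-no (suc d ℕP.≤? 0) (λ ())) refl) (zeroˡ _)) refl ⟨
    𝟙[ suc d ℕP.≤? 0 ] * F 0 + Σ≤ (d ℕ.+ M) (λ y → 𝟙[ suc d ℕP.≤? suc y ] * F (suc y))
      ≈⟨ Σ-suc (d ℕ.+ M) (λ y → 𝟙[ suc d ℕP.≤? y ] * F y) ⟨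
    Σ≤ (suc d ℕ.+ M) (λ y → 𝟙[ suc d ℕP.≤? y ] * F y) ∎

private module ℚΣ = FiniteSums ℚP.+-*-commutativeRing

module TruncatedSeries where
  open P.≡-Reasoning
  open ℚΣ using (Σ≤)

  record _≈[_]_ (f : Series) (L : ℕ) (g : Series) : Set where
    constructor mk≈
    field coeff : ∀ i → i ≤ L → f i ≡ g i
  open _≈[_]_ public

  pointwise : ∀ {L f g} → (∀ i → f i ≡ g i) → f ≈[ L ] g
  pointwise f≡g = mk≈ (λ i _ → f≡g i)

  constS-0ℚ : ∀ i → constS 0ℚ i ≡ 0ℚ
  constS-0ℚ zero    = P.refl
  constS-0ℚ (suc i) = P.refl

  *ˢ-coeff : ∀ f g n → (f *ˢ g) n ≡ Σ≤ n (λ i → f i ℚ.* g (n ∸ i))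
  *ˢ-coeff f g n = sumUpTo≡Σ≤ n _
    where
    sumUpTo≡Σ≤ : ∀ n h → sumUpTo n h ≡ Σ≤ n h
    sumUpTo≡Σ≤ zero    h = P.refl
    sumUpTo≡Σ≤ (suc n) h = P.cong (ℚ._+ h (suc n)) (sumUpTo≡Σ≤ n h)

  *ˢ-comm : ∀ f g n → (f *ˢ g) n ≡ (g *ˢ f) n
  *ˢ-comm f g n = begin
    (f *ˢ g) n                                  ≡⟨ *ˢ-coeff f g n ⟩
    Σ≤ n (λ i → f i ℚ.* g (n ∸ i))              ≡⟨ ℚΣ.Σ-reverse n _ ⟩
    Σ≤ n (λ i → f (n ∸ i) ℚ.* g (n ∸ (n ∸ i))) ≡⟨ ℚΣ.Σ-cong n swap ⟩
    Σ≤ n (λ i → g i ℚ.* f (n ∸ i))              ≡⟨ *ˢ-coeff g f n ⟨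
    (g *ˢ f) n                                  ∎
    where
    swap : ∀ i → i ≤ n → f (n ∸ i) ℚ.* g (n ∸ (n ∸ i)) ≡ g i ℚ.* f (n ∸ i)
    swap i i≤n = P.trans (ℚP.*-comm (f (n ∸ i)) (g (n ∸ (n ∸ i)))) (P.cong (λ t → g t ℚ.* f (n ∸ i)) (ℕP.m∸[m∸n]≡n i≤n))

  *ˢ-assoc : ∀ f g h n → ((f *ˢ g) *ˢ h) n ≡ (f *ˢ (g *ˢ h)) n
  *ˢ-assoc f g h n = begin
    ((f *ˢ g) *ˢ h) n
      ≡⟨ *ˢ-coeff (f *ˢ g) h n ⟩
    Σ≤ n (λ i → (f *ˢ g) i ℚ.* h (n ∸ i))
      ≡⟨ ℚΣ.Σ-cong n (λ i _ → P.trans (P.cong (ℚ._* h (n ∸ i)) (*ˢ-coeff f g i)) (ℚΣ.*-distribʳ-Σ i (h (n ∸ i)) (λ j → f j ℚ.* g (i ∸ j)))) ⟩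
    Σ≤ n (λ i → Σ≤ i (λ j → (f j ℚ.* g (i ∸ j)) ℚ.* h (n ∸ i)))
      ≡⟨ ℚΣ.Σ-triangle n _ ⟩
    Σ≤ n (λ j → Σ≤ (n ∸ j) (λ k → (f j ℚ.* g (j ℕ.+ k ∸ j)) ℚ.* h (n ∸ (j ℕ.+ k))))
      ≡⟨ ℚΣ.Σ-cong n (λ j _ → ℚΣ.Σ-cong (n ∸ j) (λ k _ → reindex j k)) ⟩
    Σ≤ n (λ j → Σ≤ (n ∸ j) (λ k → f j ℚ.* (g k ℚ.* h (n ∸ j ∸ k))))
      ≡⟨ ℚΣ.Σ-cong n (λ j _ → P.trans (P.cong (f j ℚ.*_) (*ˢ-coeff g h (n ∸ j))) (ℚΣ.*-distribˡ-Σ (n ∸ j) (f j) (λ k → g k ℚ.* h (n ∸ j ∸ k)))) ⟨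
    Σ≤ n (λ j → f j ℚ.* (g *ˢ h) (n ∸ j))
      ≡⟨ *ˢ-coeff f (g *ˢ h) n ⟨
    (f *ˢ (g *ˢ h)) n ∎
    where
    reindex : ∀ j k → (f j ℚ.* g (j ℕ.+ k ∸ j)) ℚ.* h (n ∸ (j ℕ.+ k)) ≡ f j ℚ.* (g k ℚ.* h (n ∸ j ∸ k))
    reindex j k = P.trans (ℚP.*-assoc (f j) _ _)
      (P.cong₂ (λ a b → f j ℚ.* (g a ℚ.* h b)) (ℕP.m+n∸m≡n j k) (P.sym (ℕP.∸-+-assoc n j k)))

  *ˢ-identityˡ : ∀ f n → (constS 1ℚ *ˢ f) n ≡ f n
  *ˢ-identityˡ f n = begin
    (constS 1ℚ *ˢ f) n                      ≡⟨ *ˢ-coeff (constS 1ℚ) f n ⟩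
    Σ≤ n (λ i → constS 1ℚ i ℚ.* f (n ∸ i)) ≡⟨ ℚΣ.Σ-single n 0 z≤n off ⟩
    1ℚ ℚ.* f n                              ≡⟨ ℚP.*-identityˡ (f n) ⟩
    f n                                     ∎
    where
    off : ∀ i → i ≤ n → i ≢ 0 → constS 1ℚ i ℚ.* f (n ∸ i) ≡ 0ℚ
    off zero    _ 0≢0 = ⊥-elim (0≢0 P.refl)
    off (suc i) _ _   = ℚP.*-zeroˡ (f (n ∸ suc i))

  *ˢ-distribˡ-+ˢ : ∀ f g h n → (f *ˢ (g +ˢ h)) n ≡ ((f *ˢ g) +ˢ (f *ˢ h)) n
  *ˢ-distribˡ-+ˢ f g h n = begin
    (f *ˢ (g +ˢ h)) n
      ≡⟨ *ˢ-coeff f (g +ˢ h) n ⟩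
    Σ≤ n (λ i → f i ℚ.* (g (n ∸ i) ℚ.+ h (n ∸ i)))
      ≡⟨ ℚΣ.Σ-cong n (λ i _ → ℚP.*-distribˡ-+ (f i) _ _) ⟩
    Σ≤ n (λ i → f i ℚ.* g (n ∸ i) ℚ.+ f i ℚ.* h (n ∸ i))
      ≡⟨ ℚΣ.Σ-distrib-+ n _ _ ⟩
    Σ≤ n (λ i → f i ℚ.* g (n ∸ i)) ℚ.+ Σ≤ n (λ i → f i ℚ.* h (n ∸ i))
      ≡⟨ P.cong₂ ℚ._+_ (*ˢ-coeff f g n) (*ˢ-coeff f h n) ⟨
    ((f *ˢ g) +ˢ (f *ˢ h)) n ∎

  *ˢ-cong : ∀ {L f f′ g g′} → f ≈[ L ] f′ → g ≈[ L ] g′ → (f *ˢ g) ≈[ L ] (f′ *ˢ g′)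
  *ˢ-cong {L} {f} {f′} {g} {g′} f≈f′ g≈g′ = mk≈ λ n n≤L → begin
    (f *ˢ g) n                       ≡⟨ *ˢ-coeff f g n ⟩
    Σ≤ n (λ i → f i ℚ.* g (n ∸ i))   ≡⟨ ℚΣ.Σ-cong n (λ i i≤n → P.cong₂ ℚ._*_
                                          (coeff f≈f′ i (ℕP.≤-trans i≤n n≤L))
                                          (coeff g≈g′ (n ∸ i) (ℕP.≤-trans (ℕP.m∸n≤m n i) n≤L))) ⟩
    Σ≤ n (λ i → f′ i ℚ.* g′ (n ∸ i)) ≡⟨ *ˢ-coeff f′ g′ n ⟨
    (f′ *ˢ g′) n                     ∎

  -- Opaque copies of the operations keep Agda from unfolding Cauchy products during conversion checks.
  opaque
    _⊕_ _⊛_ : Series → Series → Series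
    f ⊕ g = f +ˢ g
    f ⊛ g = f *ˢ g

    ⊖_ : Series → Series
    ⊖ f = -ˢ f

  opaque
    unfolding _⊕_

    ⊕-coeff : ∀ f g i → (f ⊕ g) i ≡ f i ℚ.+ g i
    ⊕-coeff f g i = P.refl

    ⊛-coeff : ∀ f g i → (f ⊛ g) i ≡ (f *ˢ g) i
    ⊛-coeff f g i = P.refl

    ⊖-coeff : ∀ f i → (⊖ f) i ≡ ℚ.- f i
    ⊖-coeff f i = P.refl

    isCommutativeRing : ∀ L → IsCommutativeRing _≈[ L ]_ _⊕_ _⊛_ ⊖_ (constS 0ℚ) (constS 1ℚ)
    isCommutativeRing L = record
      { isRing = record
        { +-isAbelianGroup = record
          { isGroup = record
            { isMonoid = record
              { isSemigroup = record
                { isMagma = record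
                  { isEquivalence = record
                    { refl  = pointwise (λ _ → P.refl)
                    ; sym   = λ f≈g → mk≈ (λ i i≤L → P.sym (coeff f≈g i i≤L))
                    ; trans = λ f≈g g≈h → mk≈ (λ i i≤L → P.trans (coeff f≈g i i≤L) (coeff g≈h i i≤L))
                    }
                  ; ∙-cong = λ f≈f′ g≈g′ → mk≈ (λ i i≤L → P.cong₂ ℚ._+_ (coeff f≈f′ i i≤L) (coeff g≈g′ i i≤L))
                  }
                ; assoc = λ f g h → pointwise (λ i → ℚP.+-assoc (f i) (g i) (h i))
                }
              ; identity = (λ f → pointwise (λ i → P.trans (P.cong (ℚ._+ f i) (constS-0ℚ i)) (ℚP.+-identityˡ (f i))))
                         , (λ f → pointwise (λ i → P.trans (P.cong (f i ℚ.+_) (constS-0ℚ i)) (ℚP.+-identityʳ (f i))))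
              }
            ; inverse = (λ f → pointwise (λ i → P.trans (ℚP.+-inverseˡ (f i)) (P.sym (constS-0ℚ i))))
                      , (λ f → pointwise (λ i → P.trans (ℚP.+-inverseʳ (f i)) (P.sym (constS-0ℚ i))))
            ; ⁻¹-cong = λ f≈g → mk≈ (λ i i≤L → P.cong ℚ.-_ (coeff f≈g i i≤L))
            }
          ; comm = λ f g → pointwise (λ i → ℚP.+-comm (f i) (g i))
          }
        ; *-cong     = *ˢ-cong
        ; *-assoc    = λ f g h → pointwise (*ˢ-assoc f g h)
        ; *-identity = (λ f → pointwise (*ˢ-identityˡ f))
                     , (λ f → pointwise (λ i → P.trans (*ˢ-comm f (constS 1ℚ) i) (*ˢ-identityˡ f i)))
        ; distrib    = (λ f g h → pointwise (*ˢ-distribˡ-+ˢ f g h))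
                     , (λ f g h → pointwise (λ i → begin
                         ((g +ˢ h) *ˢ f) i            ≡⟨ *ˢ-comm (g +ˢ h) f i ⟩
                         (f *ˢ (g +ˢ h)) i            ≡⟨ *ˢ-distribˡ-+ˢ f g h i ⟩
                         (f *ˢ g) i ℚ.+ (f *ˢ h) i    ≡⟨ P.cong₂ ℚ._+_ (*ˢ-comm f g i) (*ˢ-comm f h i) ⟩
                         (g *ˢ f) i ℚ.+ (h *ˢ f) i    ∎))
        }
      ; *-comm = λ f g → pointwise (*ˢ-comm f g)
      }

  -- ℚ[[q]] / (q^(1 + L)): series are identified when they agree up to degree L.
  truncated : ℕ → CommutativeRing 0ℓ 0ℓ
  truncated L = record { isCommutativeRing = isCommutativeRing L }

open TruncatedSeries

module Modulo (L : ℕ) where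
  open CommutativeRing (truncated L) public
  open import Relation.Binary.Reasoning.Setoid setoid public
  open FiniteSums (truncated L) public

  private
    constS-+ : ∀ a b i → constS (a ℚ.+ b) i ≡ constS a i ℚ.+ constS b i
    constS-+ a b zero    = P.refl
    constS-+ a b (suc i) = P.sym (ℚP.+-identityʳ 0ℚ)

    constS-* : ∀ a b i → constS (a ℚ.* b) i ≡ (constS a *ˢ constS b) i
    constS-* a b zero    = P.refl
    constS-* a b (suc i) = P.sym (P.trans (*ˢ-coeff (constS a) (constS b) (suc i)) (ℚΣ.Σ-zero (suc i) vanish))
      where
      vanish : ∀ j → j ≤ suc i → constS a j ℚ.* constS b (suc i ∸ j) ≡ 0ℚ
      vanish zero    _ = ℚP.*-zeroʳ a
      vanish (suc j) _ = ℚP.*-zeroˡ (constS b (suc i ∸ suc j))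

    constS-- : ∀ a i → constS (ℚ.- a) i ≡ ℚ.- constS a i
    constS-- a zero    = P.refl
    constS-- a (suc i) = P.refl

  constS-homomorphism : ℚ.+-*-rawRing -Raw-AlmostCommutative⟶ fromCommutativeRing (truncated L)
  constS-homomorphism = record
    { ⟦_⟧    = constS
    ; +-homo = λ a b → pointwise (λ i → P.trans (constS-+ a b i) (P.sym (⊕-coeff (constS a) (constS b) i)))
    ; *-homo = λ a b → pointwise (λ i → P.trans (constS-* a b i) (P.sym (⊛-coeff (constS a) (constS b) i)))
    ; -‿homo = λ a → pointwise (λ i → P.trans (constS-- a i) (P.sym (⊖-coeff (constS a) i)))
    ; 0-homo = refl
    ; 1-homo = refl
    }

  private
    constS-≟ : ∀ a b → Maybe (constS a ≈ constS b)
    constS-≟ a b with a ℚP.≟ b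
    ... | yes P.refl = just refl
    ... | no _       = nothing

  open import Algebra.Solver.Ring ℚ.+-*-rawRing (fromCommutativeRing (truncated L)) constS-homomorphism constS-≟ public

module Monomial where
  open import Data.Nat.Divisibility using (_∣_; _∣?_; _∣0; ∣⇒≤; ∣m∸n∣n⇒∣m; ∣m+n∣m⇒∣n; ∣-refl)
  open ℚΣ using (Σ≤; 𝟙[_])
  open P.≡-Reasoning

  infix 30 q^_
  q^_ : ℕ → Series
  (q^ e) i = 𝟙[ i ℕP.≟ e ]

  q^-coeff-≢ : ∀ e i → i ≢ e → (q^ e) i ≡ 0ℚ
  q^-coeff-≢ e i i≢e = ℚΣ.𝟙-no (i ℕP.≟ e) i≢e

  q^-coeff-≡ : ∀ e → (q^ e) e ≡ 1ℚ
  q^-coeff-≡ e = ℚΣ.𝟙-yes (e ℕP.≟ e) P.refl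

  *ˢq^-coeff : ∀ f e i → e ≤ i → (f *ˢ q^ e) i ≡ f (i ∸ e)
  *ˢq^-coeff f e i e≤i = begin
    (f *ˢ q^ e) i                          ≡⟨ *ˢ-coeff f (q^ e) i ⟩
    Σ≤ i (λ j → f j ℚ.* (q^ e) (i ∸ j))    ≡⟨ ℚΣ.Σ-single i (i ∸ e) (ℕP.m∸n≤m i e) off ⟩
    f (i ∸ e) ℚ.* (q^ e) (i ∸ (i ∸ e))     ≡⟨ P.cong (λ t → f (i ∸ e) ℚ.* (q^ e) t) (ℕP.m∸[m∸n]≡n e≤i) ⟩
    f (i ∸ e) ℚ.* (q^ e) e                 ≡⟨ P.cong (f (i ∸ e) ℚ.*_) (q^-coeff-≡ e) ⟩
    f (i ∸ e) ℚ.* 1ℚ                       ≡⟨ ℚP.*-identityʳ _ ⟩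
    f (i ∸ e)                              ∎
    where
    off : ∀ j → j ≤ i → j ≢ i ∸ e → f j ℚ.* (q^ e) (i ∸ j) ≡ 0ℚ
    off j j≤i j≢i∸e = P.trans (P.cong (f j ℚ.*_) (q^-coeff-≢ e (i ∸ j) λ i∸j≡e →
        j≢i∸e (P.trans (P.sym (ℕP.m∸[m∸n]≡n j≤i)) (P.cong (i ∸_) i∸j≡e)))) (ℚP.*-zeroʳ (f j))

  *ˢq^-coeff-< : ∀ f e i → i < e → (f *ˢ q^ e) i ≡ 0ℚ
  *ˢq^-coeff-< f e i i<e = P.trans (*ˢ-coeff f (q^ e) i) (ℚΣ.Σ-zero i λ j _ →
    P.trans (P.cong (f j ℚ.*_) (q^-coeff-≢ e (i ∸ j) λ i∸j≡e → ℕP.<-irrefl i∸j≡e (ℕP.≤-<-trans (ℕP.m∸n≤m i j) i<e)))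
            (ℚP.*-zeroʳ (f j)))

  q^*ˢq^-coeff : ∀ a b i → (q^ a *ˢ q^ b) i ≡ (q^ (a ℕ.+ b)) i
  q^*ˢq^-coeff a b i with b ℕP.≤? i
  ... | yes b≤i = P.trans (*ˢq^-coeff (q^ a) b i b≤i) (ℚΣ.𝟙-⇔ (i ∸ b ℕP.≟ a) (i ℕP.≟ a ℕ.+ b)
        (λ i∸b≡a → P.trans (P.sym (ℕP.m∸n+n≡m b≤i)) (P.cong (ℕ._+ b) i∸b≡a))
        (λ i≡a+b → P.trans (P.cong (_∸ b) i≡a+b) (ℕP.m+n∸n≡m a b)))
  ... | no  b≰i = P.trans (*ˢq^-coeff-< (q^ a) b i (ℕP.≰⇒> b≰i))
        (P.sym (q^-coeff-≢ (a ℕ.+ b) i λ i≡a+b → b≰i (ℕP.≤-trans (ℕP.m≤n+m b a) (ℕP.≤-reflexive (P.sym i≡a+b)))))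

  q^0-coeff : ∀ i → (q^ 0) i ≡ constS 1ℚ i
  q^0-coeff zero    = P.refl
  q^0-coeff (suc i) = P.refl

  -- Pq e = q^e / (1 - q^e) and Dq e = 1 / (1 - q^e) = Σ_t q^(t e).
  Pq : ℕ → Series
  Pq = qPowOverOneMinus

  Dq : ℕ → Series
  Dq e i = 𝟙[ e ∣? i ]

  Pq-coeff-< : ∀ e i → i < e → Pq e i ≡ 0ℚ
  Pq-coeff-< e zero    _   = P.refl
  Pq-coeff-< e (suc i) i<e with e ∣? suc i
  ... | yes e∣1+i = ⊥-elim (ℕP.<⇒≱ i<e (∣⇒≤ e∣1+i))
  ... | no  _     = P.refl

  Dq-coeff-≡-1+Pq : ∀ e i → Dq e i ≡ constS 1ℚ i ℚ.+ Pq e i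
  Dq-coeff-≡-1+Pq e zero with e ∣? 0
  ... | yes _   = P.refl
  ... | no  e∤0 = ⊥-elim (e∤0 (e ∣0))
  Dq-coeff-≡-1+Pq e (suc i) with e ∣? suc i
  ... | yes _ = P.refl
  ... | no  _ = P.refl

  Dq-coeff-periodic : ∀ e i → e ≤ i → Dq e (i ∸ e) ≡ Dq e i
  Dq-coeff-periodic e i e≤i = ℚΣ.𝟙-⇔ (e ∣? i ∸ e) (e ∣? i)
    (λ e∣i∸e → ∣m∸n∣n⇒∣m e e≤i e∣i∸e ∣-refl)
    (λ e∣i → ∣m+n∣m⇒∣n (P.subst (e ∣_) (P.sym (ℕP.m+[n∸m]≡n e≤i)) e∣i) ∣-refl)

  Dq-coeff-< : ∀ e i → i < e → Dq e i ≡ constS 1ℚ i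
  Dq-coeff-< e zero    _   = P.trans (Dq-coeff-≡-1+Pq e 0) (ℚP.+-identityʳ 1ℚ)
  Dq-coeff-< e (suc i) i<e = ℚΣ.𝟙-no (e ∣? suc i) (λ e∣1+i → ℕP.<⇒≱ i<e (∣⇒≤ e∣1+i))

  Dq-[1-q^]-coeff : ∀ e → 1 ≤ e → ∀ i → Dq e i ℚ.- (Dq e *ˢ q^ e) i ≡ constS 1ℚ i
  Dq-[1-q^]-coeff e 1≤e i with e ℕP.≤? i
  ... | yes e≤i = begin
    Dq e i ℚ.- (Dq e *ˢ q^ e) i ≡⟨ P.cong (λ t → Dq e i ℚ.- t) (P.trans (*ˢq^-coeff (Dq e) e i e≤i) (Dq-coeff-periodic e i e≤i)) ⟩
    Dq e i ℚ.- Dq e i           ≡⟨ ℚP.+-inverseʳ (Dq e i) ⟩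
    0ℚ                        ≡⟨ P.sym (constS-1ℚ-at-suc (ℕP.<-≤-trans 1≤e e≤i)) ⟩
    constS 1ℚ i               ∎
    where
    constS-1ℚ-at-suc : ∀ {i} → 0 < i → constS 1ℚ i ≡ 0ℚ
    constS-1ℚ-at-suc {suc i} _ = P.refl
  ... | no e≰i = begin
    Dq e i ℚ.- (Dq e *ˢ q^ e) i ≡⟨ P.cong (λ t → Dq e i ℚ.- t) (*ˢq^-coeff-< (Dq e) e i (ℕP.≰⇒> e≰i)) ⟩
    Dq e i ℚ.- 0ℚ              ≡⟨ ℚP.+-identityʳ (Dq e i) ⟩
    Dq e i                     ≡⟨ Dq-coeff-< e i (ℕP.≰⇒> e≰i) ⟩
    constS 1ℚ i               ∎

open Monomial

module SeriesAlgebra (L : ℕ) where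
  open Modulo L public

  q^-+ : ∀ a b → q^ a * q^ b ≈ q^ (a ℕ.+ b)
  q^-+ a b = pointwise (λ i → P.trans (⊛-coeff (q^ a) (q^ b) i) (q^*ˢq^-coeff a b i))

  q^0≈1 : q^ 0 ≈ 1#
  q^0≈1 = pointwise q^0-coeff

  q^-vanish : ∀ n → L < n → q^ n ≈ 0#
  q^-vanish n L<n = mk≈ (λ i i≤L → P.trans (q^-coeff-≢ n i (ℕP.<⇒≢ (ℕP.≤-<-trans i≤L L<n))) (P.sym (constS-0ℚ i)))

  Dq≈1+Pq : ∀ e → Dq e ≈ 1# + Pq e
  Dq≈1+Pq e = pointwise (λ i → P.trans (Dq-coeff-≡-1+Pq e i) (P.sym (⊕-coeff 1# (Pq e) i)))

  Dq*[1-q^]≈1 : ∀ e → 1 ≤ e → Dq e * (1# - q^ e) ≈ 1#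
  Dq*[1-q^]≈1 e 1≤e = begin
    Dq e * (1# - q^ e) ≈⟨ solve 2 (λ d m → d :* (con 1ℚ :- m) := d :- d :* m) refl (Dq e) (q^ e) ⟩
    Dq e - Dq e * q^ e ≈⟨ pointwise coefficientwise ⟩
    1#                 ∎
    where
    coefficientwise : ∀ i → (Dq e - Dq e * q^ e) i ≡ constS 1ℚ i
    coefficientwise i = P.trans (⊕-coeff (Dq e) _ i)
      (P.trans (P.cong (Dq e i ℚ.+_) (P.trans (⊖-coeff _ i) (P.cong ℚ.-_ (⊛-coeff (Dq e) (q^ e) i))))
               (Dq-[1-q^]-coeff e 1≤e i))

  Pq*[1-q^]≈q^ : ∀ e → 1 ≤ e → Pq e * (1# - q^ e) ≈ q^ e
  Pq*[1-q^]≈q^ e 1≤e = begin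
    Pq e * (1# - q^ e)
      ≈⟨ solve 2 (λ p m → p :* (con 1ℚ :- m) := (con 1ℚ :+ p) :* (con 1ℚ :- m) :- (con 1ℚ :- m)) refl (Pq e) (q^ e) ⟩
    (1# + Pq e) * (1# - q^ e) - (1# - q^ e)
      ≈⟨ +-cong (*-cong (Dq≈1+Pq e) refl) refl ⟨
    Dq e * (1# - q^ e) - (1# - q^ e)
      ≈⟨ +-cong (Dq*[1-q^]≈1 e 1≤e) refl ⟩
    1# - (1# - q^ e)
      ≈⟨ solve 1 (λ m → con 1ℚ :- (con 1ℚ :- m) := m) refl (q^ e) ⟩
    q^ e ∎

  Pq≈Dq*q^ : ∀ e → 1 ≤ e → Pq e ≈ Dq e * q^ e
  Pq≈Dq*q^ e 1≤e = begin
    Pq e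
      ≈⟨ *-identityʳ (Pq e) ⟨
    Pq e * 1#
      ≈⟨ *-cong refl (Dq*[1-q^]≈1 e 1≤e) ⟨
    Pq e * (Dq e * (1# - q^ e))
      ≈⟨ solve 3 (λ p d m → p :* (d :* (con 1ℚ :- m)) := d :* (p :* (con 1ℚ :- m))) refl (Pq e) (Dq e) (q^ e) ⟩
    Dq e * (Pq e * (1# - q^ e))
      ≈⟨ *-cong refl (Pq*[1-q^]≈q^ e 1≤e) ⟩
    Dq e * q^ e ∎

  Dq*q^≈Σ : ∀ e t → 1 ≤ e → Dq e * q^ (e ℕ.* t) ≈ Σ≤ L (λ j → 𝟙[ t ℕP.≤? j ] * q^ (e ℕ.* j))
  Dq*q^≈Σ e t 1≤e with t ℕP.≤? suc L
  ... | yes t≤1+L = begin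
    Dq e * q^ (e ℕ.* t)                                   ≈⟨ solve 2 (λ d x → d :* x := d :* x :- d :* con 0ℚ) refl (Dq e) (q^ (e ℕ.* t)) ⟩
    Dq e * q^ (e ℕ.* t) - Dq e * 0#                       ≈⟨ +-cong refl (-‿cong (*-cong refl (q^-vanish (e ℕ.* suc L) L<e[1+L]))) ⟨
    Dq e * q^ (e ℕ.* t) - Dq e * q^ (e ℕ.* suc L)         ≈⟨ solve 3 (λ d x y → d :* x :- d :* y := d :* (x :- y)) refl (Dq e) _ _ ⟩
    Dq e * (q^ (e ℕ.* t) - q^ (e ℕ.* suc L))              ≈⟨ *-cong refl (Σ-𝟙≤-telescope L t (λ j → q^ (e ℕ.* j)) t≤1+L) ⟨
    Dq e * Σ≤ L (λ j → 𝟙[ t ℕP.≤? j ] * (q^ (e ℕ.* j) - q^ (e ℕ.* suc j)))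
      ≈⟨ *-cong refl (Σ-cong L (λ j _ → term j)) ⟨
    Dq e * Σ≤ L (λ j → (1# - q^ e) * (𝟙[ t ℕP.≤? j ] * q^ (e ℕ.* j)))
      ≈⟨ *-cong refl (*-distribˡ-Σ L (1# - q^ e) _) ⟨
    Dq e * ((1# - q^ e) * Σ≤ L (λ j → 𝟙[ t ℕP.≤? j ] * q^ (e ℕ.* j)))
      ≈⟨ *-assoc _ _ _ ⟨
    (Dq e * (1# - q^ e)) * Σ≤ L (λ j → 𝟙[ t ℕP.≤? j ] * q^ (e ℕ.* j))
      ≈⟨ *-cong (Dq*[1-q^]≈1 e 1≤e) refl ⟩
    1# * Σ≤ L (λ j → 𝟙[ t ℕP.≤? j ] * q^ (e ℕ.* j))
      ≈⟨ *-identityˡ _ ⟩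
    Σ≤ L (λ j → 𝟙[ t ℕP.≤? j ] * q^ (e ℕ.* j)) ∎
    where
    L<e[1+L] : L < e ℕ.* suc L
    L<e[1+L] = ℕP.≤-trans (ℕP.≤-reflexive (P.sym (ℕP.*-identityˡ (suc L)))) (ℕP.*-monoˡ-≤ (suc L) 1≤e)
    term : ∀ j → (1# - q^ e) * (𝟙[ t ℕP.≤? j ] * q^ (e ℕ.* j)) ≈ 𝟙[ t ℕP.≤? j ] * (q^ (e ℕ.* j) - q^ (e ℕ.* suc j))
    term j = begin
      (1# - q^ e) * (𝟙[ t ℕP.≤? j ] * q^ (e ℕ.* j))
        ≈⟨ solve 3 (λ m b x → (con 1ℚ :- m) :* (b :* x) := b :* (x :- m :* x)) refl (q^ e) 𝟙[ t ℕP.≤? j ] (q^ (e ℕ.* j)) ⟩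
      𝟙[ t ℕP.≤? j ] * (q^ (e ℕ.* j) - q^ e * q^ (e ℕ.* j))
        ≈⟨ *-cong refl (+-cong refl (-‿cong (trans (q^-+ e (e ℕ.* j)) (reflexive (P.cong q^_ (P.sym (ℕP.*-suc e j))))))) ⟩
      𝟙[ t ℕP.≤? j ] * (q^ (e ℕ.* j) - q^ (e ℕ.* suc j)) ∎
  ... | no t≰1+L = begin
    Dq e * q^ (e ℕ.* t)
      ≈⟨ *-cong refl (q^-vanish (e ℕ.* t) L<et) ⟩
    Dq e * 0#
      ≈⟨ zeroʳ (Dq e) ⟩
    0#
      ≈⟨ Σ-zero L (λ j j≤L → trans (*-cong (𝟙-no (t ℕP.≤? j) (λ t≤j → t≰1+L (ℕP.≤-trans t≤j (ℕP.m≤n⇒m≤1+n j≤L)))) refl) (zeroˡ _)) ⟨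
    Σ≤ L (λ j → 𝟙[ t ℕP.≤? j ] * q^ (e ℕ.* j)) ∎
    where
    L<et : L < e ℕ.* t
    L<et = ℕP.≤-trans (ℕP.<⇒≤ (ℕP.≰⇒> t≰1+L)) (ℕP.≤-trans (ℕP.≤-reflexive (P.sym (ℕP.*-identityˡ t))) (ℕP.*-monoˡ-≤ t 1≤e))

  Pq*q^≈Σ : ∀ e k → 1 ≤ e → Pq e * q^ (e ℕ.* k) ≈ Σ≤ L (λ j → 𝟙[ k ℕP.<? j ] * q^ (e ℕ.* j))
  Pq*q^≈Σ e k 1≤e = begin
    Pq e * q^ (e ℕ.* k)          ≈⟨ *-cong (Pq≈Dq*q^ e 1≤e) refl ⟩
    (Dq e * q^ e) * q^ (e ℕ.* k) ≈⟨ *-assoc _ _ _ ⟩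
    Dq e * (q^ e * q^ (e ℕ.* k)) ≈⟨ *-cong refl (q^-+ e (e ℕ.* k)) ⟩
    Dq e * q^ (e ℕ.+ e ℕ.* k)    ≡⟨ P.cong (λ n → Dq e * q^ n) (P.sym (ℕP.*-suc e k)) ⟩
    Dq e * q^ (e ℕ.* suc k)      ≈⟨ Dq*q^≈Σ e (suc k) 1≤e ⟩
    Σ≤ L (λ j → 𝟙[ k ℕP.<? j ] * q^ (e ℕ.* j)) ∎

  infix 4 q^_∣_
  q^_∣_ : ℕ → Series → Set
  q^ v ∣ f = ∀ i → i ≤ L → i < v → f i ≡ 0ℚ

  ∣-resp-≈ : ∀ {v f g} → f ≈ g → q^ v ∣ f → q^ v ∣ g
  ∣-resp-≈ f≈g v∣f i i≤L i<v = P.trans (P.sym (coeff f≈g i i≤L)) (v∣f i i≤L i<v)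

  ∣-weaken : ∀ {v w f} → w ≤ v → q^ v ∣ f → q^ w ∣ f
  ∣-weaken w≤v v∣f i i≤L i<w = v∣f i i≤L (ℕP.<-≤-trans i<w w≤v)

  ∣-* : ∀ {a b f g} → q^ a ∣ f → q^ b ∣ g → q^ (a ℕ.+ b) ∣ f * g
  ∣-* {a} {b} {f} {g} a∣f b∣g i i≤L i<a+b = P.trans (⊛-coeff f g i) (P.trans (*ˢ-coeff f g i) (ℚΣ.Σ-zero i vanish))
    where
    vanish : ∀ j → j ≤ i → f j ℚ.* g (i ∸ j) ≡ 0ℚ
    vanish j j≤i with j ℕP.<? a
    ... | yes j<a = P.trans (P.cong (ℚ._* g (i ∸ j)) (a∣f j (ℕP.≤-trans j≤i i≤L) j<a)) (ℚP.*-zeroˡ (g (i ∸ j)))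
    ... | no  j≮a = P.trans (P.cong (f j ℚ.*_) (b∣g (i ∸ j) (ℕP.≤-trans (ℕP.m∸n≤m i j) i≤L) i∸j<b)) (ℚP.*-zeroʳ (f j))
      where
      i∸j<b : i ∸ j < b
      i∸j<b = ℕP.+-cancelˡ-< j (i ∸ j) b (P.subst (ℕ._< j ℕ.+ b) (P.sym (ℕP.m+[n∸m]≡n j≤i))
                (ℕP.<-≤-trans i<a+b (ℕP.+-monoˡ-≤ b (ℕP.≮⇒≥ j≮a))))

  ∣-*ʳ : ∀ {a} f {g} → q^ a ∣ g → q^ a ∣ f * g
  ∣-*ʳ f a∣g = ∣-* {0} {f = f} (λ _ _ ()) a∣g

  ∣-+ : ∀ {a f g} → q^ a ∣ f → q^ a ∣ g → q^ a ∣ f + g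
  ∣-+ {f = f} {g} a∣f a∣g i i≤L i<a = P.trans (⊕-coeff f g i) (P.cong₂ ℚ._+_ (a∣f i i≤L i<a) (a∣g i i≤L i<a))

  ∣-neg : ∀ {a f} → q^ a ∣ f → q^ a ∣ - f
  ∣-neg {f = f} a∣f i i≤L i<a = P.trans (⊖-coeff f i) (P.cong ℚ.-_ (a∣f i i≤L i<a))

  ∣-0 : ∀ {a} → q^ a ∣ 0#
  ∣-0 i _ _ = constS-0ℚ i

  ∣-Σ : ∀ {a} n (f : ℕ → Series) → (∀ j → j ≤ n → q^ a ∣ f j) → q^ a ∣ Σ≤ n f
  ∣-Σ zero    f a∣f = a∣f 0 z≤n
  ∣-Σ (suc n) f a∣f = ∣-+ (∣-Σ n f (λ j j≤n → a∣f j (ℕP.m≤n⇒m≤1+n j≤n))) (a∣f (suc n) ℕP.≤-refl)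

  q^∣q^ : ∀ e → q^ e ∣ q^ e
  q^∣q^ e i _ i<e = q^-coeff-≢ e i (ℕP.<⇒≢ i<e)

  q^∣Pq : ∀ e → q^ e ∣ Pq e
  q^∣Pq e i _ i<e = Pq-coeff-< e i i<e

  q^[1+L]∣⇒≈0 : ∀ {f} → q^ (suc L) ∣ f → f ≈ 0#
  q^[1+L]∣⇒≈0 ∣f = mk≈ (λ i i≤L → P.trans (∣f i i≤L (s≤s i≤L)) (P.sym (constS-0ℚ i)))

  Pq-vanish : ∀ k → L < k → Pq k ≈ 0#
  Pq-vanish k L<k = q^[1+L]∣⇒≈0 (∣-weaken L<k (q^∣Pq k))

module Matrices (L : ℕ) where
  open SeriesAlgebra L public

  Vector Matrix : Set
  Vector = ℕ → Series
  Matrix = ℕ → ℕ → Series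

  infix  4 _≈ᵛ_
  infixl 7 _⊲_ _⊙_
  infixr 7 _⊳_

  _≈ᵛ_ : Vector → Vector → Set
  r ≈ᵛ r′ = ∀ n → n ≤ L → r n ≈ r′ n

  _⊲_ : Vector → Matrix → Vector
  (r ⊲ X) m = Σ≤ L (λ n → r n * X n m)

  _⊳_ : Matrix → Vector → Vector
  (Y ⊳ c) n = Σ≤ L (λ m → Y n m * c m)

  _⊙_ : Matrix → Matrix → Matrix
  (X ⊙ Y) n m = Σ≤ L (λ j → X n j * Y j m)

  ⟨_∣_∣_⟩ : Vector → Matrix → Vector → Series
  ⟨ r ∣ Z ∣ c ⟩ = Σ≤ L (λ n → Σ≤ L (λ m → r n * Z n m * c m))

  ⟨⟩-cong : ∀ {r r′ c c′} Z → r ≈ᵛ r′ → c ≈ᵛ c′ → ⟨ r ∣ Z ∣ c ⟩ ≈ ⟨ r′ ∣ Z ∣ c′ ⟩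
  ⟨⟩-cong Z r≈r′ c≈c′ = Σ-cong L (λ n n≤L → Σ-cong L (λ m m≤L → *-cong (*-cong (r≈r′ n n≤L) refl) (c≈c′ m m≤L)))

  ⟨⊲∣⟩ : ∀ r X Z c → ⟨ r ⊲ X ∣ Z ∣ c ⟩ ≈ Σ≤ L (λ n → Σ≤ L (λ m → r n * (X ⊙ Z) n m * c m))
  ⟨⊲∣⟩ r X Z c = begin
    Σ≤ L (λ j → Σ≤ L (λ m → (r ⊲ X) j * Z j m * c m))
      ≈⟨ Σ-cong L (λ j _ → Σ-cong L (λ m _ → trans (*-cong (*-distribʳ-Σ L (Z j m) _) refl) (*-distribʳ-Σ L (c m) _))) ⟩
    Σ≤ L (λ j → Σ≤ L (λ m → Σ≤ L (λ n → r n * X n j * Z j m * c m)))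
      ≈⟨ Σ-cong L (λ j _ → Σ-swap L L _) ⟩
    Σ≤ L (λ j → Σ≤ L (λ n → Σ≤ L (λ m → r n * X n j * Z j m * c m)))
      ≈⟨ Σ-swap L L _ ⟩
    Σ≤ L (λ n → Σ≤ L (λ j → Σ≤ L (λ m → r n * X n j * Z j m * c m)))
      ≈⟨ Σ-cong L (λ n _ → Σ-swap L L _) ⟩
    Σ≤ L (λ n → Σ≤ L (λ m → Σ≤ L (λ j → r n * X n j * Z j m * c m)))
      ≈⟨ Σ-cong L (λ n _ → Σ-cong L (λ m _ → Σ-cong L (λ j _ → *-cong (*-assoc _ _ _) refl))) ⟩
    Σ≤ L (λ n → Σ≤ L (λ m → Σ≤ L (λ j → r n * (X n j * Z j m) * c m)))
      ≈⟨ Σ-cong L (λ n _ → Σ-cong L (λ m _ → trans (*-cong (*-distribˡ-Σ L (r n) _) refl) (*-distribʳ-Σ L (c m) _))) ⟨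
    Σ≤ L (λ n → Σ≤ L (λ m → r n * (X ⊙ Z) n m * c m)) ∎

  ⟨∣⊳⟩ : ∀ r Z Y c → ⟨ r ∣ Z ∣ Y ⊳ c ⟩ ≈ Σ≤ L (λ n → Σ≤ L (λ m → r n * (Z ⊙ Y) n m * c m))
  ⟨∣⊳⟩ r Z Y c = begin
    Σ≤ L (λ n → Σ≤ L (λ j → r n * Z n j * (Y ⊳ c) j))
      ≈⟨ Σ-cong L (λ n _ → Σ-cong L (λ j _ → *-distribˡ-Σ L (r n * Z n j) _)) ⟩
    Σ≤ L (λ n → Σ≤ L (λ j → Σ≤ L (λ m → r n * Z n j * (Y j m * c m))))
      ≈⟨ Σ-cong L (λ n _ → Σ-swap L L _) ⟩
    Σ≤ L (λ n → Σ≤ L (λ m → Σ≤ L (λ j → r n * Z n j * (Y j m * c m))))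
      ≈⟨ Σ-cong L (λ n _ → Σ-cong L (λ m _ → Σ-cong L (λ j _ → reassoc (r n) (Z n j) (Y j m) (c m)))) ⟩
    Σ≤ L (λ n → Σ≤ L (λ m → Σ≤ L (λ j → r n * (Z n j * Y j m) * c m)))
      ≈⟨ Σ-cong L (λ n _ → Σ-cong L (λ m _ → trans (*-cong (*-distribˡ-Σ L (r n) _) refl) (*-distribʳ-Σ L (c m) _))) ⟨
    Σ≤ L (λ n → Σ≤ L (λ m → r n * (Z ⊙ Y) n m * c m)) ∎
    where
    reassoc : ∀ a b d e → a * b * (d * e) ≈ a * (b * d) * e
    reassoc = solve 4 (λ a b d e → a :* b :* (d :* e) := a :* (b :* d) :* e) refl

  -- X Z = Z Y, as far as the bilinear form ⟨ r ∣ · ∣ c ⟩ can see.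
  Intertwined : Vector → Matrix → Matrix → Matrix → Vector → Set
  Intertwined r X Z Y c = ∀ n m → n ≤ L → m ≤ L → r n * (X ⊙ Z) n m * c m ≈ r n * (Z ⊙ Y) n m * c m

  ⟨⊲∣⟩≈⟨∣⊳⟩ : ∀ r X Z Y c → Intertwined r X Z Y c → ⟨ r ⊲ X ∣ Z ∣ c ⟩ ≈ ⟨ r ∣ Z ∣ Y ⊳ c ⟩
  ⟨⊲∣⟩≈⟨∣⊳⟩ r X Z Y c XC≈CY = begin
    ⟨ r ⊲ X ∣ Z ∣ c ⟩                                  ≈⟨ ⟨⊲∣⟩ r X Z c ⟩
    Σ≤ L (λ n → Σ≤ L (λ m → r n * (X ⊙ Z) n m * c m)) ≈⟨ Σ-cong L (λ n n≤L → Σ-cong L (λ m m≤L → XC≈CY n m n≤L m≤L)) ⟩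
    Σ≤ L (λ n → Σ≤ L (λ m → r n * (Z ⊙ Y) n m * c m)) ≈⟨ ⟨∣⊳⟩ r Z Y c ⟨
    ⟨ r ∣ Z ∣ Y ⊳ c ⟩                                  ∎

  -- Moving the letters of w one at a time from the row side to the column side.
  transfer : (row col : List Letter → Vector) (X Y : Letter → Matrix) (Z : Matrix) →
             (∀ u x → row (u ++ [ x ]) ≈ᵛ row u ⊲ X x) →
             (∀ x v → col (x ∷ v) ≈ᵛ Y x ⊳ col v) →
             ∀ w → (∀ u x v → u ++ x ∷ v ≡ w → Intertwined (row u) (X x) Z (Y x) (col v)) →
             ⟨ row w ∣ Z ∣ col [] ⟩ ≈ ⟨ row [] ∣ Z ∣ col w ⟩
  transfer row col X Y Z row-snoc col-cons w intertwined = sym (go w [] P.refl)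
    where
    go : ∀ v u → u ++ v ≡ w → ⟨ row u ∣ Z ∣ col v ⟩ ≈ ⟨ row w ∣ Z ∣ col [] ⟩
    go []      u P.refl rewrite LP.++-identityʳ u = refl
    go (x ∷ v) u u++x∷v≡w = begin
      ⟨ row u ∣ Z ∣ col (x ∷ v) ⟩   ≈⟨ ⟨⟩-cong Z (λ _ _ → refl) (col-cons x v) ⟩
      ⟨ row u ∣ Z ∣ Y x ⊳ col v ⟩   ≈⟨ ⟨⊲∣⟩≈⟨∣⊳⟩ (row u) (X x) Z (Y x) (col v) (intertwined u x v u++x∷v≡w) ⟨
      ⟨ row u ⊲ X x ∣ Z ∣ col v ⟩   ≈⟨ ⟨⟩-cong Z (λ n n≤L → sym (row-snoc u x n n≤L)) (λ _ _ → refl) ⟩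
      ⟨ row (u ++ [ x ]) ∣ Z ∣ col v ⟩ ≈⟨ go v (u ++ [ x ]) (P.trans (LP.++-assoc u [ x ] v) u++x∷v≡w) ⟩
      ⟨ row w ∣ Z ∣ col [] ⟩        ∎

-- AB, AC contribute the factor 1 (and count towards d), BD, CD the factor Pq,
-- AD the factor Dq and BC the factor 0.
data Kind : Set where
  κ₁ κP κD κ₀ : Kind

kind : Letter → Kind
kind eAB = κ₁
kind eAC = κ₁
kind eAD = κD
kind eBC = κ₀
kind eBD = κP
kind eCD = κP

dual : Kind → Kind
dual κ₁ = κP
dual κP = κ₁
dual κD = κD
dual κ₀ = κ₀

kind-τL : ∀ x → kind (τL x) ≡ dual (kind x)
kind-τL eAB = P.refl
kind-τL eAC = P.refl
kind-τL eAD = P.refl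
kind-τL eBC = P.refl
kind-τL eBD = P.refl
kind-τL eCD = P.refl

module TransferMatrices (L : ℕ) where
  open Matrices L public

  I : Matrix
  I n m = 𝟙[ n ℕP.≟ m ]

  -- The defining sum of f, rewritten in the levels y_j = n_j + d_j, is a product of the matrices N.
  N : Kind → Matrix
  N κ₁ n m = 𝟙[ n ℕP.<? m ]
  N κP n m = 𝟙[ n ℕP.≤? m ] * Pq m
  N κD n m = 𝟙[ n ℕP.≤? m ] * Dq m
  N κ₀ n m = 0#

  Nᵀ : Kind → Matrix
  Nᵀ κ n m = N κ m n

  M : Kind → Matrix
  M κ₁ n m = 𝟙[ n ℕP.≟ m ] * Pq m
  M κP n m = 𝟙[ n ℕP.<? m ] * Dq m
  M κD n m = 𝟙[ n ℕP.≤? m ] * Dq m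
  M κ₀ n m = 0#

  Q : Matrix
  Q n m = q^ (n ℕ.* m)

  I⊙ : ∀ X n m → n ≤ L → (I ⊙ X) n m ≈ X n m
  I⊙ X n m n≤L = Σ-𝟙≟ L n (λ j → X j m) n≤L

  ⊙I : ∀ X n m → m ≤ L → (X ⊙ I) n m ≈ X n m
  ⊙I X n m m≤L = trans (Σ-cong L (λ j _ → trans (*-comm _ _) (*-cong (𝟙-⇔ (j ℕP.≟ m) (m ℕP.≟ j) P.sym P.sym) refl)))
                       (Σ-𝟙≟ L m (X n) m≤L)

  private
    𝟙-split : ∀ n m → 𝟙[ n ℕP.≤? m ] ≈ 𝟙[ n ℕP.≟ m ] + 𝟙[ n ℕP.<? m ]
    𝟙-split n m with n ℕP.≤? m | n ℕP.≟ m | n ℕP.<? m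
    ... | yes _   | yes P.refl | yes n<n = ⊥-elim (ℕP.<-irrefl P.refl n<n)
    ... | yes _   | yes _      | no  _   = sym (+-identityʳ 1#)
    ... | yes _   | no  _      | yes _   = sym (+-identityˡ 1#)
    ... | yes n≤m | no  n≢m    | no  n≮m = ⊥-elim (n≮m (ℕP.≤∧≢⇒< n≤m n≢m))
    ... | no  n≰m | yes P.refl | _       = ⊥-elim (n≰m ℕP.≤-refl)
    ... | no  n≰m | no  _      | yes n<m = ⊥-elim (n≰m (ℕP.<⇒≤ n<m))
    ... | no  _   | no  _      | no  _   = sym (+-identityˡ 0#)

  M-κD-split : ∀ n m → M κD n m ≈ I n m + M κ₁ n m + M κP n m
  M-κD-split n m = begin
    𝟙[ n ℕP.≤? m ] * Dq m
      ≈⟨ *-cong (𝟙-split n m) (Dq≈1+Pq m) ⟩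
    (𝟙[ n ℕP.≟ m ] + 𝟙[ n ℕP.<? m ]) * (1# + Pq m)
      ≈⟨ solve 3 (λ e l p → (e :+ l) :* (con 1ℚ :+ p) := e :+ e :* p :+ l :* (con 1ℚ :+ p)) refl _ _ _ ⟩
    𝟙[ n ℕP.≟ m ] + 𝟙[ n ℕP.≟ m ] * Pq m + 𝟙[ n ℕP.<? m ] * (1# + Pq m)
      ≈⟨ +-cong refl (*-cong refl (Dq≈1+Pq m)) ⟨
    𝟙[ n ℕP.≟ m ] + 𝟙[ n ℕP.≟ m ] * Pq m + 𝟙[ n ℕP.<? m ] * Dq m ∎

  N-κD-split : ∀ n m → N κD n m ≈ I n m + N κ₁ n m + N κP n m
  N-κD-split n m = begin
    𝟙[ n ℕP.≤? m ] * Dq m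
      ≈⟨ *-cong (𝟙-split n m) (Dq≈1+Pq m) ⟩
    (𝟙[ n ℕP.≟ m ] + 𝟙[ n ℕP.<? m ]) * (1# + Pq m)
      ≈⟨ solve 3 (λ e l p → (e :+ l) :* (con 1ℚ :+ p) := e :+ l :+ (e :+ l) :* p) refl _ _ _ ⟩
    𝟙[ n ℕP.≟ m ] + 𝟙[ n ℕP.<? m ] + (𝟙[ n ℕP.≟ m ] + 𝟙[ n ℕP.<? m ]) * Pq m
      ≈⟨ +-cong refl (*-cong (𝟙-split n m) refl) ⟨
    𝟙[ n ℕP.≟ m ] + 𝟙[ n ℕP.<? m ] + 𝟙[ n ℕP.≤? m ] * Pq m ∎

  intertwine-κD : ∀ Z (N′ : Kind → Matrix) n m → n ≤ L → m ≤ L →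
                  (∀ j → N′ κD j m ≈ I j m + N′ κ₁ j m + N′ κP j m) →
                  (M κ₁ ⊙ Z) n m ≈ (Z ⊙ N′ κ₁) n m → (M κP ⊙ Z) n m ≈ (Z ⊙ N′ κP) n m →
                  (M κD ⊙ Z) n m ≈ (Z ⊙ N′ κD) n m
  intertwine-κD Z N′ n m n≤L m≤L N′-split κ₁-rel κP-rel = begin
    Σ≤ L (λ j → M κD n j * Z j m)
      ≈⟨ Σ-cong L (λ j _ → *-cong (M-κD-split n j) refl) ⟩
    Σ≤ L (λ j → (I n j + M κ₁ n j + M κP n j) * Z j m)
      ≈⟨ Σ-cong L (λ j _ → trans (distribʳ _ _ _) (+-cong (distribʳ _ _ _) refl)) ⟩
    Σ≤ L (λ j → I n j * Z j m + M κ₁ n j * Z j m + M κP n j * Z j m)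
      ≈⟨ trans (Σ-distrib-+ L _ _) (+-cong (Σ-distrib-+ L _ _) refl) ⟩
    (I ⊙ Z) n m + (M κ₁ ⊙ Z) n m + (M κP ⊙ Z) n m
      ≈⟨ +-cong (+-cong (trans (I⊙ Z n m n≤L) (sym (⊙I Z n m m≤L))) κ₁-rel) κP-rel ⟩
    (Z ⊙ I) n m + (Z ⊙ N′ κ₁) n m + (Z ⊙ N′ κP) n m
      ≈⟨ trans (Σ-distrib-+ L _ _) (+-cong (Σ-distrib-+ L _ _) refl) ⟨
    Σ≤ L (λ j → Z n j * I j m + Z n j * N′ κ₁ j m + Z n j * N′ κP j m)
      ≈⟨ Σ-cong L (λ j _ → trans (distribˡ _ _ _) (+-cong (distribˡ _ _ _) refl)) ⟨
    Σ≤ L (λ j → Z n j * (I j m + N′ κ₁ j m + N′ κP j m))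
      ≈⟨ Σ-cong L (λ j _ → *-cong refl (N′-split j)) ⟨
    Σ≤ L (λ j → Z n j * N′ κD j m) ∎

  Q-κ₁ : ∀ n m → 1 ≤ n → n ≤ L → (M κ₁ ⊙ Q) n m ≈ (Q ⊙ Nᵀ κ₁) n m
  Q-κ₁ n m 1≤n n≤L = begin
    Σ≤ L (λ j → 𝟙[ n ℕP.≟ j ] * Pq j * q^ (j ℕ.* m))     ≈⟨ Σ-cong L (λ j _ → *-assoc _ _ _) ⟩
    Σ≤ L (λ j → 𝟙[ n ℕP.≟ j ] * (Pq j * q^ (j ℕ.* m)))   ≈⟨ Σ-𝟙≟ L n (λ j → Pq j * q^ (j ℕ.* m)) n≤L ⟩
    Pq n * q^ (n ℕ.* m)                                  ≈⟨ Pq*q^≈Σ n m 1≤n ⟩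
    Σ≤ L (λ j → 𝟙[ m ℕP.<? j ] * q^ (n ℕ.* j))           ≈⟨ Σ-cong L (λ j _ → *-comm _ _) ⟩
    Σ≤ L (λ j → q^ (n ℕ.* j) * 𝟙[ m ℕP.<? j ])           ∎

  Q-κP : ∀ n m → 1 ≤ m → (M κP ⊙ Q) n m ≈ (Q ⊙ Nᵀ κP) n m
  Q-κP n m 1≤m = begin
    Σ≤ L (λ j → 𝟙[ n ℕP.<? j ] * Dq j * q^ (j ℕ.* m))
      ≈⟨ Σ-cong L (λ j _ → expandˡ j) ⟩
    Σ≤ L (λ j → Σ≤ L (λ k → 𝟙[ n ℕP.<? j ] * 𝟙[ m ℕP.≤? k ] * q^ (j ℕ.* k)))
      ≈⟨ Σ-swap L L _ ⟩
    Σ≤ L (λ k → Σ≤ L (λ j → 𝟙[ n ℕP.<? j ] * 𝟙[ m ℕP.≤? k ] * q^ (j ℕ.* k)))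
      ≈⟨ Σ-cong L (λ k _ → expandʳ k) ⟨
    Σ≤ L (λ k → q^ (n ℕ.* k) * (𝟙[ m ℕP.≤? k ] * Pq k)) ∎
    where
    expandˡ : ∀ j → 𝟙[ n ℕP.<? j ] * Dq j * q^ (j ℕ.* m) ≈ Σ≤ L (λ k → 𝟙[ n ℕP.<? j ] * 𝟙[ m ℕP.≤? k ] * q^ (j ℕ.* k))
    expandˡ j with n ℕP.<? j
    ... | yes n<j = begin
      1# * Dq j * q^ (j ℕ.* m)                            ≈⟨ trans (*-assoc _ _ _) (*-identityˡ _) ⟩
      Dq j * q^ (j ℕ.* m)                                 ≈⟨ Dq*q^≈Σ j m (ℕP.≤-trans (s≤s z≤n) n<j) ⟩
      Σ≤ L (λ k → 𝟙[ m ℕP.≤? k ] * q^ (j ℕ.* k))          ≈⟨ Σ-cong L (λ k _ → sym (*-cong (*-identityˡ _) refl)) ⟩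
      Σ≤ L (λ k → 1# * 𝟙[ m ℕP.≤? k ] * q^ (j ℕ.* k))     ∎
    ... | no _ = trans (trans (*-assoc _ _ _) (zeroˡ _)) (sym (Σ-zero L (λ k _ → trans (*-cong (zeroˡ _) refl) (zeroˡ _))))
    expandʳ : ∀ k → q^ (n ℕ.* k) * (𝟙[ m ℕP.≤? k ] * Pq k) ≈ Σ≤ L (λ j → 𝟙[ n ℕP.<? j ] * 𝟙[ m ℕP.≤? k ] * q^ (j ℕ.* k))
    expandʳ k with m ℕP.≤? k
    ... | yes m≤k = begin
      q^ (n ℕ.* k) * (1# * Pq k)
        ≈⟨ solve 2 (λ x p → x :* (con 1ℚ :* p) := p :* x) refl _ _ ⟩
      Pq k * q^ (n ℕ.* k)
        ≡⟨ P.cong (λ e → Pq k * q^ e) (ℕP.*-comm n k) ⟩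
      Pq k * q^ (k ℕ.* n)
        ≈⟨ Pq*q^≈Σ k n (ℕP.≤-trans 1≤m m≤k) ⟩
      Σ≤ L (λ j → 𝟙[ n ℕP.<? j ] * q^ (k ℕ.* j))
        ≈⟨ Σ-cong L (λ j _ → *-cong (sym (*-identityʳ _)) (reflexive (P.cong q^_ (ℕP.*-comm k j)))) ⟩
      Σ≤ L (λ j → 𝟙[ n ℕP.<? j ] * 1# * q^ (j ℕ.* k)) ∎
    ... | no _ = trans (trans (*-cong refl (zeroˡ _)) (zeroʳ _)) (sym (Σ-zero L (λ j _ → trans (*-cong (zeroʳ _) refl) (zeroˡ _))))

  Q-κD : ∀ n m → 1 ≤ n → 1 ≤ m → n ≤ L → m ≤ L → (M κD ⊙ Q) n m ≈ (Q ⊙ Nᵀ κD) n m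
  Q-κD n m 1≤n 1≤m n≤L m≤L = intertwine-κD Q Nᵀ n m n≤L m≤L
    (λ j → trans (N-κD-split m j) (+-cong (+-cong (𝟙-⇔ (m ℕP.≟ j) (j ℕP.≟ m) P.sym P.sym) refl) refl))
    (Q-κ₁ n m 1≤n n≤L) (Q-κP n m 1≤m)

module Connector (L : ℕ) where
  open TransferMatrices L public

  qPoch : ℕ → ℕ → Series
  qPoch a zero    = 1#
  qPoch a (suc k) = qPoch a k * (1# - q^ (a ℕ.+ k))

  qPoch-peel : ∀ a k → qPoch a (suc k) ≈ (1# - q^ a) * qPoch (suc a) k
  qPoch-peel a zero    = trans (*-identityˡ _) (trans (reflexive (P.cong (λ e → 1# - q^ e) (ℕP.+-identityʳ a))) (sym (*-identityʳ _)))
  qPoch-peel a (suc k) = begin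
    qPoch a (suc k) * (1# - q^ (a ℕ.+ suc k))             ≈⟨ *-cong (qPoch-peel a k) (reflexive (P.cong (λ e → 1# - q^ e) (ℕP.+-suc a k))) ⟩
    (1# - q^ a) * qPoch (suc a) k * (1# - q^ (suc a ℕ.+ k)) ≈⟨ *-assoc _ _ _ ⟩
    (1# - q^ a) * qPoch (suc a) (suc k)                   ∎

  -- K≤ n m = Σ_{j ≤ m} K n j and K< n m = Σ_{j < m} K n j.
  K≤ : ℕ → ℕ → Series
  K≤ n m = 𝟙[ n ℕP.≤? m ] * qPoch (suc (m ∸ n)) n

  K< : ℕ → ℕ → Series
  K< n zero    = 0#
  K< n (suc m) = K≤ n m

  K : Matrix
  K n m = K≤ n m - K< n m

  K≤-diagonal : ∀ a n → K≤ n (a ℕ.+ n) ≈ qPoch (suc a) n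
  K≤-diagonal a n = trans (*-cong (𝟙-yes (n ℕP.≤? a ℕ.+ n) (ℕP.m≤n+m n a)) refl)
    (trans (*-identityˡ _) (reflexive (P.cong (λ e → qPoch (suc e) n) (ℕP.m+n∸n≡m a n))))

  K≤-below : ∀ n m → m < n → K≤ n m ≈ 0#
  K≤-below n m m<n = trans (*-cong (𝟙-no (n ℕP.≤? m) (ℕP.<⇒≱ m<n)) refl) (zeroˡ _)

  K<-below : ∀ n m → m ≤ n → K< n m ≈ 0#
  K<-below n zero    _     = refl
  K<-below n (suc m) 1+m≤n = K≤-below n m 1+m≤n

  K≤0 : ∀ m → K≤ 0 m ≈ 1#
  K≤0 m = trans (*-cong (𝟙-yes (0 ℕP.≤? m) z≤n) refl) (*-identityˡ _)

  K-rowsum : ∀ n m → m ≤ L → Σ≤ L (λ j → 𝟙[ j ℕP.≤? m ] * K n j) ≈ K≤ n m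
  K-rowsum n m m≤L = begin
    Σ≤ L (λ j → 𝟙[ j ℕP.≤? m ] * K n j)
      ≈⟨ Σ-truncate L m m≤L (λ i m<i _ → trans (*-cong (𝟙-no (i ℕP.≤? m) (ℕP.<⇒≱ m<i)) refl) (zeroˡ _)) ⟩
    Σ≤ m (λ j → 𝟙[ j ℕP.≤? m ] * K n j)
      ≈⟨ Σ-cong m (λ j j≤m → trans (*-cong (𝟙-yes (j ℕP.≤? m) j≤m) refl) (*-identityˡ _)) ⟩
    Σ≤ m (λ j → K< n (suc j) - K< n j)
      ≈⟨ Σ-telescope m (K< n) ⟩
    K≤ n m - 0#
      ≈⟨ solve 1 (λ x → x :- con 0ℚ := x) refl (K≤ n m) ⟩
    K≤ n m ∎

  Pq*K : ∀ n m → 1 ≤ n → Pq n * K n m ≈ K≤ n m * Pq m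
  Pq*K (suc n′) m _ with m ℕP.<? suc n′
  ... | yes m<n = begin
    Pq n * (K≤ n m - K< n m) ≈⟨ *-cong refl (+-cong (K≤-below n m m<n) (-‿cong (K<-below n m (ℕP.<⇒≤ m<n)))) ⟩
    Pq n * (0# - 0#)         ≈⟨ solve 2 (λ p p′ → p :* (con 0ℚ :- con 0ℚ) := con 0ℚ :* p′) refl (Pq n) (Pq m) ⟩
    0# * Pq m                ≈⟨ *-cong (K≤-below n m m<n) refl ⟨
    K≤ n m * Pq m            ∎
    where n = suc n′
  ... | no m≮n rewrite P.sym (ℕP.m∸n+n≡m (ℕP.≮⇒≥ m≮n)) = diagonal (m ∸ suc n′)
    where
    n = suc n′
    diagonal : ∀ a → Pq n * K n (a ℕ.+ n) ≈ K≤ n (a ℕ.+ n) * Pq (a ℕ.+ n)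
    diagonal zero = begin
      Pq n * (K≤ n n - K< n n) ≈⟨ *-cong refl (+-cong (K≤-diagonal 0 n) (-‿cong (K<-below n n ℕP.≤-refl))) ⟩
      Pq n * (qPoch 1 n - 0#)  ≈⟨ solve 2 (λ p x → p :* (x :- con 0ℚ) := x :* p) refl (Pq n) (qPoch 1 n) ⟩
      qPoch 1 n * Pq n         ≈⟨ *-cong (K≤-diagonal 0 n) refl ⟨
      K≤ n n * Pq n            ∎
    diagonal (suc a) = begin
      Pq n * (K≤ n m′ - K≤ n (a ℕ.+ n))
        ≈⟨ *-cong refl (+-cong (K≤-diagonal (suc a) n) (-‿cong (K≤-diagonal a n))) ⟩
      Pq n * (qPoch (suc b) n - qPoch b n)
        ≈⟨ *-cong refl (+-cong refl (-‿cong (qPoch-peel b n′))) ⟩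
      Pq n * (X * (1# - q^ (suc b ℕ.+ n′)) - (1# - q^ b) * X)
        ≈⟨ *-cong refl (+-cong (*-cong refl (+-cong refl (-‿cong q^[b+n]))) refl) ⟩
      Pq n * (X * (1# - q^ b * q^ n) - (1# - q^ b) * X)
        ≈⟨ solve 4 (λ p x y z → p :* (x :* (con 1ℚ :- y :* z) :- (con 1ℚ :- y) :* x) := x :* y :* (p :* (con 1ℚ :- z))) refl (Pq n) X (q^ b) (q^ n) ⟩
      X * q^ b * (Pq n * (1# - q^ n))
        ≈⟨ *-cong refl (Pq*[1-q^]≈q^ n (s≤s z≤n)) ⟩
      X * q^ b * q^ n
        ≈⟨ trans (*-assoc _ _ _) (*-cong refl (q^-+ b n)) ⟩
      X * q^ m′
        ≈⟨ *-cong refl (Pq*[1-q^]≈q^ m′ (s≤s z≤n)) ⟨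
      X * (Pq m′ * (1# - q^ m′))
        ≈⟨ solve 3 (λ x p y → x :* (p :* (con 1ℚ :- y)) := x :* (con 1ℚ :- y) :* p) refl X (Pq m′) (q^ m′) ⟩
      X * (1# - q^ m′) * Pq m′
        ≡⟨ P.cong (λ e → X * (1# - q^ e) * Pq m′) (ℕP.+-suc b n′) ⟩
      qPoch (suc b) n * Pq m′
        ≈⟨ *-cong (K≤-diagonal (suc a) n) refl ⟨
      K≤ n m′ * Pq m′ ∎
      where
      b = suc a
      m′ = suc a ℕ.+ n
      X = qPoch (suc b) n′
      q^[b+n] : q^ (suc b ℕ.+ n′) ≈ q^ b * q^ n
      q^[b+n] = trans (reflexive (P.cong q^_ (P.sym (ℕP.+-suc b n′)))) (sym (q^-+ b n))

  Dq*K : ∀ j m → Dq (suc j) * K (suc j) (suc m) ≈ K≤ j m - K≤ (suc j) m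
  Dq*K j m with ℕP.<-cmp j m
  ... | tri< j<m _ _ rewrite P.sym (ℕP.m∸n+n≡m j<m) = below (m ∸ suc j)
    where
    below : ∀ c → Dq (suc j) * K (suc j) (suc c ℕ.+ suc j) ≈ K≤ j (c ℕ.+ suc j) - K≤ (suc j) (c ℕ.+ suc j)
    below c = begin
      Dq j′ * (K≤ j′ (suc c ℕ.+ j′) - K≤ j′ (c ℕ.+ j′))
        ≈⟨ *-cong refl (+-cong (K≤-diagonal (suc c) j′) (-‿cong (K≤-diagonal c j′))) ⟩
      Dq j′ * (qPoch (suc b) j′ - qPoch b j′)
        ≈⟨ *-cong refl (+-cong refl (-‿cong (qPoch-peel b j))) ⟩
      Dq j′ * (X * (1# - q^ (suc b ℕ.+ j)) - (1# - q^ b) * X)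
        ≈⟨ *-cong refl (+-cong (*-cong refl (+-cong refl (-‿cong q^[b+j]))) refl) ⟩
      Dq j′ * (X * (1# - q^ b * q^ j′) - (1# - q^ b) * X)
        ≈⟨ solve 4 (λ d x y z → d :* (x :* (con 1ℚ :- y :* z) :- (con 1ℚ :- y) :* x) := x :* y :* (d :* (con 1ℚ :- z))) refl (Dq j′) X (q^ b) (q^ j′) ⟩
      X * q^ b * (Dq j′ * (1# - q^ j′))
        ≈⟨ *-cong refl (Dq*[1-q^]≈1 j′ (s≤s z≤n)) ⟩
      X * q^ b * 1#
        ≈⟨ solve 2 (λ x y → x :* y :* con 1ℚ := x :- (con 1ℚ :- y) :* x) refl X (q^ b) ⟩
      X - (1# - q^ b) * X
        ≈⟨ +-cong (sym (K≤-diagonal b j)) (-‿cong (trans (sym (qPoch-peel b j)) (sym (K≤-diagonal c j′)))) ⟩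
      K≤ j (b ℕ.+ j) - K≤ j′ (c ℕ.+ j′)
        ≡⟨ P.cong (λ e → K≤ j e - K≤ j′ (c ℕ.+ j′)) (P.sym (ℕP.+-suc c j)) ⟩
      K≤ j (c ℕ.+ j′) - K≤ j′ (c ℕ.+ j′) ∎
      where
      j′ = suc j
      b = suc c
      X = qPoch (suc b) j
      q^[b+j] : q^ (suc b ℕ.+ j) ≈ q^ b * q^ j′
      q^[b+j] = trans (reflexive (P.cong q^_ (P.sym (ℕP.+-suc b j)))) (sym (q^-+ b j′))
  ... | tri≈ _ P.refl _ = begin
    Dq j′ * (K≤ j′ j′ - K≤ j′ j)
      ≈⟨ *-cong refl (+-cong (K≤-diagonal 0 j′) (-‿cong (K≤-below j′ j ℕP.≤-refl))) ⟩
    Dq j′ * (qPoch 1 j * (1# - q^ j′) - 0#)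
      ≈⟨ solve 3 (λ d x y → d :* (x :* (con 1ℚ :- y) :- con 0ℚ) := x :* (d :* (con 1ℚ :- y))) refl (Dq j′) (qPoch 1 j) (q^ j′) ⟩
    qPoch 1 j * (Dq j′ * (1# - q^ j′))
      ≈⟨ *-cong refl (Dq*[1-q^]≈1 j′ (s≤s z≤n)) ⟩
    qPoch 1 j * 1#
      ≈⟨ solve 1 (λ x → x :* con 1ℚ := x :- con 0ℚ) refl (qPoch 1 j) ⟩
    qPoch 1 j - 0#
      ≈⟨ +-cong (sym (K≤-diagonal 0 j)) (-‿cong (sym (K≤-below j′ j ℕP.≤-refl))) ⟩
    K≤ j j - K≤ j′ j ∎
    where j′ = suc j
  ... | tri> _ _ m<j = begin
    Dq (suc j) * (K≤ (suc j) (suc m) - K≤ (suc j) m)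
      ≈⟨ *-cong refl (+-cong (K≤-below (suc j) (suc m) (s≤s m<j)) (-‿cong (K≤-below (suc j) m (ℕP.m<n⇒m<1+n m<j)))) ⟩
    Dq (suc j) * (0# - 0#)
      ≈⟨ solve 1 (λ d → d :* (con 0ℚ :- con 0ℚ) := con 0ℚ :- con 0ℚ) refl (Dq (suc j)) ⟩
    0# - 0#
      ≈⟨ +-cong (sym (K≤-below j m m<j)) (-‿cong (sym (K≤-below (suc j) m (ℕP.m<n⇒m<1+n m<j)))) ⟩
    K≤ j m - K≤ (suc j) m ∎

  K-κ₁ : ∀ n m → 1 ≤ n → n ≤ L → m ≤ L → (M κ₁ ⊙ K) n m ≈ (K ⊙ N κP) n m
  K-κ₁ n m 1≤n n≤L m≤L = begin
    Σ≤ L (λ j → 𝟙[ n ℕP.≟ j ] * Pq j * K j m)          ≈⟨ Σ-cong L (λ j _ → *-assoc _ _ _) ⟩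
    Σ≤ L (λ j → 𝟙[ n ℕP.≟ j ] * (Pq j * K j m))        ≈⟨ Σ-𝟙≟ L n (λ j → Pq j * K j m) n≤L ⟩
    Pq n * K n m                                       ≈⟨ Pq*K n m 1≤n ⟩
    K≤ n m * Pq m                                      ≈⟨ *-cong (K-rowsum n m m≤L) refl ⟨
    Σ≤ L (λ j → 𝟙[ j ℕP.≤? m ] * K n j) * Pq m         ≈⟨ *-distribʳ-Σ L (Pq m) _ ⟩
    Σ≤ L (λ j → 𝟙[ j ℕP.≤? m ] * K n j * Pq m)         ≈⟨ Σ-cong L (λ j _ → solve 3 (λ b k p → b :* k :* p := k :* (b :* p)) refl _ _ _) ⟩
    Σ≤ L (λ j → K n j * (𝟙[ j ℕP.≤? m ] * Pq m))       ∎

  MκP⊙K≈K< : ∀ n m → n ≤ L → m ≤ L → (M κP ⊙ K) n m ≈ K< n m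
  MκP⊙K≈K< n zero _ _ = Σ-zero L vanish
    where
    vanish : ∀ j → j ≤ L → 𝟙[ n ℕP.<? j ] * Dq j * K j 0 ≈ 0#
    vanish zero    _ = trans (*-cong (*-cong (𝟙-no (n ℕP.<? 0) (λ ())) refl) refl) (trans (*-cong (zeroˡ _) refl) (zeroˡ _))
    vanish (suc j) _ = trans (*-cong refl (+-cong (K≤-below (suc j) 0 (s≤s z≤n)) refl)) (trans (*-cong refl (-‿inverseʳ 0#)) (zeroʳ _))
  MκP⊙K≈K< n (suc m) n≤L 1+m≤L = begin
    Σ≤ L (λ j → 𝟙[ n ℕP.<? j ] * Dq j * K j (suc m))
      ≈⟨ Σ-pred L _ 1≤L ⟩
    𝟙[ n ℕP.<? 0 ] * Dq 0 * K 0 (suc m) + Σ≤ (L ∸ 1) (λ i → 𝟙[ n ℕP.<? suc i ] * Dq (suc i) * K (suc i) (suc m))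
      ≈⟨ +-cong (trans (*-cong (*-cong (𝟙-no (n ℕP.<? 0) (λ ())) refl) refl) (trans (*-cong (zeroˡ _) refl) (zeroˡ _)))
                (Σ-cong (L ∸ 1) (λ i _ → trans (*-assoc _ _ _) (*-cong (𝟙-⇔ (n ℕP.<? suc i) (n ℕP.≤? i) ℕP.≤-pred s≤s) (Dq*K i m)))) ⟩
    0# + Σ≤ (L ∸ 1) (λ i → 𝟙[ n ℕP.≤? i ] * (K≤ i m - K≤ (suc i) m))
      ≈⟨ +-identityˡ _ ⟩
    Σ≤ (L ∸ 1) (λ i → 𝟙[ n ℕP.≤? i ] * (K≤ i m - K≤ (suc i) m))
      ≈⟨ Σ-𝟙≤-telescope (L ∸ 1) n (λ i → K≤ i m) (ℕP.≤-trans n≤L (ℕP.≤-reflexive (P.sym [L∸1]+1≡L))) ⟩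
    K≤ n m - K≤ (suc (L ∸ 1)) m
      ≈⟨ +-cong refl (-‿cong (K≤-below (suc (L ∸ 1)) m (P.subst (m <_) (P.sym [L∸1]+1≡L) 1+m≤L))) ⟩
    K≤ n m - 0#
      ≈⟨ solve 1 (λ x → x :- con 0ℚ := x) refl (K≤ n m) ⟩
    K≤ n m ∎
    where
    1≤L : 1 ≤ L
    1≤L = ℕP.≤-trans (s≤s z≤n) 1+m≤L
    [L∸1]+1≡L : suc (L ∸ 1) ≡ L
    [L∸1]+1≡L = ℕP.m+[n∸m]≡n 1≤L

  K⊙Nκ₁≈K< : ∀ n m → m ≤ L → (K ⊙ N κ₁) n m ≈ K< n m
  K⊙Nκ₁≈K< n zero    _     = Σ-zero L (λ j _ → trans (*-cong refl (𝟙-no (j ℕP.<? 0) (λ ()))) (zeroʳ _))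
  K⊙Nκ₁≈K< n (suc m) 1+m≤L = begin
    Σ≤ L (λ j → K n j * 𝟙[ j ℕP.<? suc m ])
      ≈⟨ Σ-cong L (λ j _ → trans (*-comm _ _) (*-cong (𝟙-⇔ (j ℕP.<? suc m) (j ℕP.≤? m) ℕP.≤-pred s≤s) refl)) ⟩
    Σ≤ L (λ j → 𝟙[ j ℕP.≤? m ] * K n j)
      ≈⟨ K-rowsum n m (ℕP.≤-trans (ℕP.n≤1+n m) 1+m≤L) ⟩
    K≤ n m ∎

  K-κP : ∀ n m → n ≤ L → m ≤ L → (M κP ⊙ K) n m ≈ (K ⊙ N κ₁) n m
  K-κP n m n≤L m≤L = trans (MκP⊙K≈K< n m n≤L m≤L) (sym (K⊙Nκ₁≈K< n m m≤L))

  K-κD : ∀ n m → 1 ≤ n → n ≤ L → m ≤ L → (M κD ⊙ K) n m ≈ (K ⊙ N κD) n m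
  K-κD n m 1≤n n≤L m≤L = intertwine-κD K (λ κ → N (dual κ)) n m n≤L m≤L
    (λ j → trans (N-κD-split j m) (solve 3 (λ x y z → x :+ y :+ z := x :+ z :+ y) refl _ _ _))
    (K-κ₁ n m 1≤n n≤L m≤L) (K-κP n m n≤L m≤L)

τ-snoc : ∀ u x → τ (u ++ [ x ]) ≡ τL x ∷ τ u
τ-snoc u x = P.trans (P.cong reverse (LP.map-++ τL u [ x ])) (LP.reverse-++ (map τL u) [ τL x ])

LastOK-suffix : ∀ u y v → LastOK (u ++ y ∷ v) → LastOK (y ∷ v)
LastOK-suffix []          y v ok = ok
LastOK-suffix (_ ∷ [])    y v ok = ok
LastOK-suffix (_ ∷ b ∷ u) y v ok = LastOK-suffix (b ∷ u) y v ok

FirstOK-τ : ∀ w → LastOK w → FirstOK (τ w)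
FirstOK-τ w ok with reverseView w
... | []         = tt
... | u ∶ _ ∶ʳ y rewrite τ-snoc u y = λ bad → LastOK-suffix u y [] ok (BadFirst-τL y bad)
  where
  BadFirst-τL : ∀ y → BadFirst (τL y) → BadLast y
  BadFirst-τL eAD bad = bad
  BadFirst-τL eBD bad = bad
  BadFirst-τL eCD bad = bad

module Transfers (L : ℕ) where
  open Connector L public

  e₀ ones : Vector
  e₀ n   = 𝟙[ n ℕP.≟ 0 ]
  ones _ = 1#

  -- β w y sums the terms of the defining series of f(w) whose first level n₁ + d₁ equals y.
  α β γ : Word → Vector
  α w = foldl (λ r x → r ⊲ M (kind x)) e₀ w
  β []      = e₀
  β (x ∷ v) = β v ⊲ N (kind x)
  γ []      = ones
  γ (x ∷ v) = N (dual (kind x)) ⊳ γ v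

  α-snoc : ∀ u x → α (u ++ [ x ]) ≈ᵛ α u ⊲ M (kind x)
  α-snoc u x n _ = reflexive (P.cong (λ r → r n) (LP.foldl-++ (λ r x → r ⊲ M (kind x)) e₀ u [ x ]))

  β∘τ-snoc : ∀ u x → β (τ (u ++ [ x ])) ≈ᵛ β (τ u) ⊲ N (dual (kind x))
  β∘τ-snoc u x n _ = reflexive (P.trans (P.cong (λ w → β w n) (τ-snoc u x)) (P.cong (λ κ → (β (τ u) ⊲ N κ) n) (kind-τL x)))

  β-cons : ∀ x v → β (x ∷ v) ≈ᵛ Nᵀ (kind x) ⊳ β v
  β-cons x v n _ = Σ-cong L (λ m _ → *-comm _ _)

  γ-cons : ∀ x v → γ (x ∷ v) ≈ᵛ N (dual (kind x)) ⊳ γ v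
  γ-cons x v n _ = refl

  ⊲-vanish₀ : ∀ r X → r 0 ≈ 0# → (∀ n → X (suc n) 0 ≈ 0#) → (r ⊲ X) 0 ≈ 0#
  ⊲-vanish₀ r X r₀≈0 X-lower = Σ-zero L vanish
    where
    vanish : ∀ n → n ≤ L → r n * X n 0 ≈ 0#
    vanish zero    _ = trans (*-cong r₀≈0 refl) (zeroˡ _)
    vanish (suc n) _ = trans (*-cong refl (X-lower n)) (zeroʳ _)

  M-lower : ∀ κ n → M κ (suc n) 0 ≈ 0#
  M-lower κ₁ n = zeroˡ _
  M-lower κP n = zeroˡ _
  M-lower κD n = zeroˡ _
  M-lower κ₀ n = refl

  N-lower : ∀ κ n → N κ (suc n) 0 ≈ 0#
  N-lower κ₁ n = refl
  N-lower κP n = zeroˡ _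
  N-lower κD n = zeroˡ _
  N-lower κ₀ n = refl

  α-vanish₀ : ∀ y u → ¬ BadFirst y → α (y ∷ u) 0 ≈ 0#
  α-vanish₀ y u ok = foldl-vanish₀ u (e₀ ⊲ M (kind y)) (first-column y ok)
    where
    foldl-vanish₀ : ∀ u r → r 0 ≈ 0# → foldl (λ r x → r ⊲ M (kind x)) r u 0 ≈ 0#
    foldl-vanish₀ []      r r₀≈0 = r₀≈0
    foldl-vanish₀ (x ∷ u) r r₀≈0 = foldl-vanish₀ u (r ⊲ M (kind x)) (⊲-vanish₀ r (M (kind x)) r₀≈0 (M-lower (kind x)))
    first-column : ∀ y → ¬ BadFirst y → (e₀ ⊲ M (kind y)) 0 ≈ 0#
    first-column eAB ok = ⊥-elim (ok tt)
    first-column eAC ok = ⊥-elim (ok tt)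
    first-column eAD ok = ⊥-elim (ok tt)
    first-column eBC _  = Σ-zero L (λ n _ → zeroʳ _)
    first-column eBD _  = Σ-zero L (λ n _ → trans (*-cong refl (trans (*-cong (𝟙-no (n ℕP.<? 0) (λ ())) refl) (zeroˡ _))) (zeroʳ _))
    first-column eCD _  = first-column eBD (λ ())

  β-vanish₀ : ∀ y v → LastOK (y ∷ v) → β (y ∷ v) 0 ≈ 0#
  β-vanish₀ y (z ∷ v) ok = ⊲-vanish₀ (β (z ∷ v)) (N (kind y)) (β-vanish₀ z v ok) (N-lower (kind y))
  β-vanish₀ eAB []    _  = Σ-zero L (λ n _ → trans (*-cong refl (𝟙-no (n ℕP.<? 0) (λ ()))) (zeroʳ _))
  β-vanish₀ eAC []    _  = β-vanish₀ eAB [] (λ ())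
  β-vanish₀ eBC []    _  = Σ-zero L (λ n _ → zeroʳ _)
  β-vanish₀ eAD []    ok = ⊥-elim (ok tt)
  β-vanish₀ eBD []    ok = ⊥-elim (ok tt)
  β-vanish₀ eCD []    ok = ⊥-elim (ok tt)

  module _ {w} (adm : Admissible w) where

    α-prefix-vanish₀ : ∀ u x v → u ++ x ∷ v ≡ w → BadFirst x → α u 0 ≈ 0#
    α-prefix-vanish₀ []      x v P.refl bad = ⊥-elim (proj₁ adm bad)
    α-prefix-vanish₀ (y ∷ u) x v P.refl _   = α-vanish₀ y u (proj₁ adm)

    β-suffix-vanish₀ : ∀ u x v → u ++ x ∷ v ≡ w → BadLast x → β v 0 ≈ 0#
    β-suffix-vanish₀ u x []      P.refl bad = ⊥-elim (LastOK-suffix u x [] (proj₂ adm) bad)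
    β-suffix-vanish₀ u x (z ∷ v) P.refl _   = β-vanish₀ z v (LastOK-suffix u x (z ∷ v) (proj₂ adm))

    private
      weigh : ∀ {r a b c} → a ≈ b → r * a * c ≈ r * b * c
      weigh a≈b = *-cong (*-cong refl a≈b) refl

      weigh-row : ∀ {r a b c} → r ≈ 0# → r * a * c ≈ r * b * c
      weigh-row {r} {a} {b} {c} r≈0 = begin
        r * a * c  ≈⟨ *-cong (*-cong r≈0 refl) refl ⟩
        0# * a * c ≈⟨ solve 3 (λ a b c → con 0ℚ :* a :* c := con 0ℚ :* b :* c) refl a b c ⟩
        0# * b * c ≈⟨ *-cong (*-cong r≈0 refl) refl ⟨
        r * b * c  ∎

      weigh-col : ∀ {r a b c} → c ≈ 0# → r * a * c ≈ r * b * c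
      weigh-col {r} {a} {b} {c} c≈0 = begin
        r * a * c  ≈⟨ *-cong refl c≈0 ⟩
        r * a * 0# ≈⟨ solve 3 (λ r a b → r :* a :* con 0ℚ := r :* b :* con 0ℚ) refl r a b ⟩
        r * b * 0# ≈⟨ *-cong refl c≈0 ⟨
        r * b * c  ∎

      κ₀-both-zero : ∀ Z Y n m → (∀ j → Y j m ≈ 0#) → (M κ₀ ⊙ Z) n m ≈ (Z ⊙ Y) n m
      κ₀-both-zero Z Y n m Y≈0 = trans (Σ-zero L (λ j _ → zeroˡ _)) (sym (Σ-zero L (λ j _ → trans (*-cong refl (Y≈0 j)) (zeroʳ _))))

    intertwined-Q : ∀ u x v → u ++ x ∷ v ≡ w → Intertwined (α u) (M (kind x)) Q (Nᵀ (kind x)) (β v)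
    intertwined-Q u eAB v eq zero    m       _   _   = weigh-row (α-prefix-vanish₀ u eAB v eq tt)
    intertwined-Q u eAB v eq (suc n) m       n≤L _   = weigh (Q-κ₁ (suc n) m (s≤s z≤n) n≤L)
    intertwined-Q u eAC v eq zero    m       _   _   = weigh-row (α-prefix-vanish₀ u eAC v eq tt)
    intertwined-Q u eAC v eq (suc n) m       n≤L _   = weigh (Q-κ₁ (suc n) m (s≤s z≤n) n≤L)
    intertwined-Q u eBD v eq n       zero    _   _   = weigh-col (β-suffix-vanish₀ u eBD v eq tt)
    intertwined-Q u eBD v eq n       (suc m) _   _   = weigh (Q-κP n (suc m) (s≤s z≤n))
    intertwined-Q u eCD v eq n       zero    _   _   = weigh-col (β-suffix-vanish₀ u eCD v eq tt)
    intertwined-Q u eCD v eq n       (suc m) _   _   = weigh (Q-κP n (suc m) (s≤s z≤n))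
    intertwined-Q u eAD v eq zero    m       _   _   = weigh-row (α-prefix-vanish₀ u eAD v eq tt)
    intertwined-Q u eAD v eq (suc n) zero    _   _   = weigh-col (β-suffix-vanish₀ u eAD v eq tt)
    intertwined-Q u eAD v eq (suc n) (suc m) n≤L m≤L = weigh (Q-κD (suc n) (suc m) (s≤s z≤n) (s≤s z≤n) n≤L m≤L)
    intertwined-Q u eBC v eq n       m       _   _   = weigh (κ₀-both-zero Q (Nᵀ κ₀) n m (λ _ → refl))

    intertwined-K : ∀ u x v → u ++ x ∷ v ≡ w → Intertwined (α u) (M (kind x)) K (N (dual (kind x))) (γ v)
    intertwined-K u eAB v eq zero    m _   _   = weigh-row (α-prefix-vanish₀ u eAB v eq tt)
    intertwined-K u eAB v eq (suc n) m n≤L m≤L = weigh (K-κ₁ (suc n) m (s≤s z≤n) n≤L m≤L)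
    intertwined-K u eAC v eq zero    m _   _   = weigh-row (α-prefix-vanish₀ u eAC v eq tt)
    intertwined-K u eAC v eq (suc n) m n≤L m≤L = weigh (K-κ₁ (suc n) m (s≤s z≤n) n≤L m≤L)
    intertwined-K u eBD v eq n       m n≤L m≤L = weigh (K-κP n m n≤L m≤L)
    intertwined-K u eCD v eq n       m n≤L m≤L = weigh (K-κP n m n≤L m≤L)
    intertwined-K u eAD v eq zero    m _   _   = weigh-row (α-prefix-vanish₀ u eAD v eq tt)
    intertwined-K u eAD v eq (suc n) m n≤L m≤L = weigh (K-κD (suc n) m (s≤s z≤n) n≤L m≤L)
    intertwined-K u eBC v eq n       m _   _   = weigh (κ₀-both-zero K (N κ₀) n m (λ _ → refl))

    transfer-Q : ⟨ α w ∣ Q ∣ e₀ ⟩ ≈ ⟨ e₀ ∣ Q ∣ β w ⟩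
    transfer-Q = transfer α β (λ x → M (kind x)) (λ x → Nᵀ (kind x)) Q α-snoc β-cons w intertwined-Q

    transfer-K : ⟨ α w ∣ K ∣ ones ⟩ ≈ ⟨ e₀ ∣ K ∣ γ w ⟩
    transfer-K = transfer α γ (λ x → M (kind x)) (λ x → N (dual (kind x))) K α-snoc γ-cons w intertwined-K

  transfer-I : ∀ w → ⟨ β (τ w) ∣ I ∣ ones ⟩ ≈ ⟨ e₀ ∣ I ∣ γ w ⟩
  transfer-I w = transfer (λ u → β (τ u)) γ (λ x → N (dual (kind x))) (λ x → N (dual (kind x))) I β∘τ-snoc γ-cons w
    (λ u x v _ n m n≤L m≤L → let X = N (dual (kind x)) in *-cong (*-cong refl (trans (⊙I X n m m≤L) (sym (I⊙ X n m n≤L)))) refl)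

module Duality (L : ℕ) where
  open Transfers L public

  ⟨e₀∣ : ∀ Z c → ⟨ e₀ ∣ Z ∣ c ⟩ ≈ Σ≤ L (λ m → Z 0 m * c m)
  ⟨e₀∣ Z c = begin
    Σ≤ L (λ n → Σ≤ L (λ m → e₀ n * Z n m * c m)) ≈⟨ Σ-single L 0 z≤n (λ n _ n≢0 → Σ-zero L (λ m _ → off n n≢0 m)) ⟩
    Σ≤ L (λ m → 1# * Z 0 m * c m)                ≈⟨ Σ-cong L (λ m _ → *-cong (*-identityˡ _) refl) ⟩
    Σ≤ L (λ m → Z 0 m * c m)                     ∎
    where
    off : ∀ n → n ≢ 0 → ∀ m → e₀ n * Z n m * c m ≈ 0#
    off n n≢0 m = trans (*-cong (*-cong (𝟙-no (n ℕP.≟ 0) n≢0) refl) refl) (trans (*-cong (zeroˡ _) refl) (zeroˡ _))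

  ∣e₀⟩ : ∀ r Z → ⟨ r ∣ Z ∣ e₀ ⟩ ≈ Σ≤ L (λ n → r n * Z n 0)
  ∣e₀⟩ r Z = Σ-cong L (λ n _ → trans (Σ-single L 0 z≤n (λ m _ m≢0 → off n m m≢0)) (*-identityʳ _))
    where
    off : ∀ n m → m ≢ 0 → r n * Z n m * e₀ m ≈ 0#
    off n m m≢0 = trans (*-cong refl (𝟙-no (m ℕP.≟ 0) m≢0)) (zeroʳ _)

  ∣ones⟩ : ∀ r Z → ⟨ r ∣ Z ∣ ones ⟩ ≈ Σ≤ L (λ n → r n * Σ≤ L (Z n))
  ∣ones⟩ r Z = Σ-cong L (λ n _ → trans (Σ-cong L (λ m _ → *-identityʳ _)) (sym (*-distribˡ-Σ L (r n) (Z n))))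

  ⟨∣Q∣e₀⟩ : ∀ r → ⟨ r ∣ Q ∣ e₀ ⟩ ≈ Σ≤ L r
  ⟨∣Q∣e₀⟩ r = trans (∣e₀⟩ r Q) (Σ-cong L (λ n _ → trans (*-cong refl (trans (reflexive (P.cong q^_ (ℕP.*-zeroʳ n))) q^0≈1)) (*-identityʳ _)))

  ⟨e₀∣Q∣⟩ : ∀ c → ⟨ e₀ ∣ Q ∣ c ⟩ ≈ Σ≤ L c
  ⟨e₀∣Q∣⟩ c = trans (⟨e₀∣ Q c) (Σ-cong L (λ m _ → trans (*-cong q^0≈1 refl) (*-identityˡ _)))

  ⟨∣K∣ones⟩ : ∀ r → ⟨ r ∣ K ∣ ones ⟩ ≈ Σ≤ L (λ n → r n * K≤ n L)
  ⟨∣K∣ones⟩ r = trans (∣ones⟩ r K) (Σ-cong L (λ n _ → *-cong refl (begin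
    Σ≤ L (λ m → K< n (suc m) - K< n m) ≈⟨ Σ-telescope L (K< n) ⟩
    K≤ n L - 0#                        ≈⟨ solve 1 (λ x → x :- con 0ℚ := x) refl (K≤ n L) ⟩
    K≤ n L                             ∎)))

  ⟨e₀∣K∣⟩ : ∀ c → ⟨ e₀ ∣ K ∣ c ⟩ ≈ c 0
  ⟨e₀∣K∣⟩ c = begin
    ⟨ e₀ ∣ K ∣ c ⟩             ≈⟨ ⟨e₀∣ K c ⟩
    Σ≤ L (λ m → K 0 m * c m)   ≈⟨ Σ-single L 0 z≤n off ⟩
    (K≤ 0 0 - 0#) * c 0        ≈⟨ *-cong (+-cong (K≤0 0) refl) refl ⟩
    (1# - 0#) * c 0            ≈⟨ solve 1 (λ x → (con 1ℚ :- con 0ℚ) :* x := x) refl (c 0) ⟩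
    c 0                        ∎
    where
    off : ∀ m → m ≤ L → m ≢ 0 → K 0 m * c m ≈ 0#
    off zero    _ 0≢0 = ⊥-elim (0≢0 P.refl)
    off (suc m) _ _   = trans (*-cong (trans (+-cong (K≤0 (suc m)) (-‿cong (K≤0 m))) (-‿inverseʳ 1#)) refl) (zeroˡ _)

  ⟨∣I∣ones⟩ : ∀ r → ⟨ r ∣ I ∣ ones ⟩ ≈ Σ≤ L r
  ⟨∣I∣ones⟩ r = trans (∣ones⟩ r I) (Σ-cong L (λ n n≤L → trans (*-cong refl (row-sum n n≤L)) (*-identityʳ _)))
    where
    row-sum : ∀ n → n ≤ L → Σ≤ L (I n) ≈ 1#
    row-sum n n≤L = trans (Σ-cong L (λ m _ → sym (*-identityʳ _))) (Σ-𝟙≟ L n (λ _ → 1#) n≤L)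

  ⟨e₀∣I∣⟩ : ∀ c → ⟨ e₀ ∣ I ∣ c ⟩ ≈ c 0
  ⟨e₀∣I∣⟩ c = trans (⟨e₀∣ I c) (Σ-𝟙≟ L 0 c z≤n)

  q^∣qPoch-1 : ∀ a k → q^ a ∣ qPoch a k - 1#
  q^∣qPoch-1 a zero    = ∣-resp-≈ (sym (-‿inverseʳ 1#)) (∣-0 {a})
  q^∣qPoch-1 a (suc k) = ∣-resp-≈ (sym split) (∣-+ (q^∣qPoch-1 a k) (∣-neg (∣-*ʳ (qPoch a k) (∣-weaken (ℕP.m≤m+n a k) (q^∣q^ (a ℕ.+ k))))))
    where
    split : qPoch a k * (1# - q^ (a ℕ.+ k)) - 1# ≈ (qPoch a k - 1#) + - (qPoch a k * q^ (a ℕ.+ k))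
    split = solve 2 (λ x y → x :* (con 1ℚ :- y) :- con 1ℚ := (x :- con 1ℚ) :+ :- (x :* y)) refl (qPoch a k) (q^ (a ℕ.+ k))

  -- The last letter of an admissible word has kind κ₁ or κ₀, whose matrices M raise
  -- the q-adic valuation of column n to n.
  q^∣α : ∀ w → LastOK w → ∀ n → q^ n ∣ α w n
  q^∣α []      _  zero    = λ _ _ ()
  q^∣α []      _  (suc n) = ∣-resp-≈ (sym (𝟙-no (suc n ℕP.≟ 0) (λ ()))) (∣-0 {suc n})
  q^∣α (y ∷ u) ok n       = foldl-last u e₀ y ok
    where
    last : ∀ r y → LastOK (y ∷ []) → q^ n ∣ (r ⊲ M (kind y)) n
    last r eAB _  = ∣-Σ L _ (λ j _ → ∣-*ʳ (r j) (∣-*ʳ 𝟙[ j ℕP.≟ n ] (q^∣Pq n)))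
    last r eAC _  = last r eAB (λ ())
    last r eBC _  = ∣-Σ L _ (λ j _ → ∣-*ʳ (r j) (∣-0 {n}))
    last r eAD ok = ⊥-elim (ok tt)
    last r eBD ok = ⊥-elim (ok tt)
    last r eCD ok = ⊥-elim (ok tt)
    foldl-last : ∀ u r y → LastOK (y ∷ u) → q^ n ∣ foldl (λ r x → r ⊲ M (kind x)) (r ⊲ M (kind y)) u n
    foldl-last []      r y ok = last r y ok
    foldl-last (z ∷ u) r y ok = foldl-last u (r ⊲ M (kind y)) z ok

  α*K≤≈α : ∀ w → LastOK w → ∀ n → n ≤ L → α w n * K≤ n L ≈ α w n
  α*K≤≈α w ok n n≤L = begin
    α w n * K≤ n L
      ≈⟨ *-cong refl (trans (*-cong (𝟙-yes (n ℕP.≤? L) n≤L) refl) (*-identityˡ _)) ⟩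
    α w n * qPoch a n
      ≈⟨ solve 2 (λ x p → x :* p := x :+ x :* (p :- con 1ℚ)) refl (α w n) (qPoch a n) ⟩
    α w n + α w n * (qPoch a n - 1#)
      ≈⟨ +-cong refl (q^[1+L]∣⇒≈0 (∣-weaken (ℕP.≤-reflexive (P.sym n+a≡1+L)) (∣-* (q^∣α w ok n) (q^∣qPoch-1 a n)))) ⟩
    α w n + 0#
      ≈⟨ +-identityʳ _ ⟩
    α w n ∎
    where
    a = suc (L ∸ n)
    n+a≡1+L : n ℕ.+ a ≡ suc L
    n+a≡1+L = P.trans (ℕP.+-suc n (L ∸ n)) (P.cong suc (ℕP.m+[n∸m]≡n n≤L))

  Σβ≈Σβ∘τ : ∀ w → Admissible w → Σ≤ L (β w) ≈ Σ≤ L (β (τ w))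
  Σβ≈Σβ∘τ w adm = begin
    Σ≤ L (β w)                       ≈⟨ ⟨e₀∣Q∣⟩ (β w) ⟨
    ⟨ e₀ ∣ Q ∣ β w ⟩                 ≈⟨ transfer-Q adm ⟨
    ⟨ α w ∣ Q ∣ e₀ ⟩                 ≈⟨ ⟨∣Q∣e₀⟩ (α w) ⟩
    Σ≤ L (α w)                       ≈⟨ Σ-cong L (α*K≤≈α w (proj₂ adm)) ⟨
    Σ≤ L (λ n → α w n * K≤ n L)      ≈⟨ ⟨∣K∣ones⟩ (α w) ⟨
    ⟨ α w ∣ K ∣ ones ⟩               ≈⟨ transfer-K adm ⟩
    ⟨ e₀ ∣ K ∣ γ w ⟩                 ≈⟨ ⟨e₀∣K∣⟩ (γ w) ⟩
    γ w 0                            ≈⟨ ⟨e₀∣I∣⟩ (γ w) ⟨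
    ⟨ e₀ ∣ I ∣ γ w ⟩                 ≈⟨ transfer-I w ⟨
    ⟨ β (τ w) ∣ I ∣ ones ⟩           ≈⟨ ⟨∣I∣ones⟩ (β (τ w)) ⟩
    Σ≤ L (β (τ w))                   ∎

private
  open import Algebra.Properties.Ring (CommutativeRing.ring ℚP.+-*-commutativeRing) using (-‿involutive)

  0-[-p]≡p : ∀ i p → constS 0ℚ i ℚ.- (ℚ.- p) ≡ p
  0-[-p]≡p i p = P.trans (P.cong₂ ℚ._+_ (constS-0ℚ i) (-‿involutive p)) (ℚP.+-identityˡ p)

weight : Kind → ℕ → Series
weight κ₁ _ = constS 1ℚ
weight κP y = Pq y
weight κD y = Dq y
weight κ₀ _ = constS 0ℚ

factor-coeff : ∀ x n d i → factor x n d i ≡ weight (kind x) (n ℕ.+ d) i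
factor-coeff eAB n d zero    = P.refl
factor-coeff eAB n d (suc i) = P.refl
factor-coeff eAC n d zero    = P.refl
factor-coeff eAC n d (suc i) = P.refl
factor-coeff eBC n d zero    = P.refl
factor-coeff eBC n d (suc i) = P.refl
factor-coeff eAD n d i       = P.trans (P.cong (constS 1ℚ i ℚ.+_) (-‿involutive _)) (P.sym (Dq-coeff-≡-1+Pq (n ℕ.+ d) i))
factor-coeff eBD n d i       = 0-[-p]≡p i (Pq (n ℕ.+ d) i)
factor-coeff eCD n d i       = 0-[-p]≡p i (Pq (n ℕ.+ d) i)

module PartialSums (L : ℕ) where
  open Duality L public

  sumSeries≈Σ : ∀ M F → sumSeries M F ≈ Σ≤ M F
  sumSeries≈Σ zero    F = refl
  sumSeries≈Σ (suc M) F = trans (pointwise (λ i → P.sym (⊕-coeff (sumSeries M F) (F (suc M)) i))) (+-cong (sumSeries≈Σ M F) refl)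

  partialSum-cons : ∀ x xs M → partialSum (x ∷ xs) M ≈ Σ≤ M (λ n → weight (kind x) (n ℕ.+ dCount (x ∷ xs)) * partialSum xs n)
  partialSum-cons x xs M = trans (sumSeries≈Σ M _) (Σ-cong M (λ n _ → term n))
    where
    d = dCount (x ∷ xs)
    term : ∀ n → factor x n d *ˢ partialSum xs n ≈ weight (kind x) (n ℕ.+ d) * partialSum xs n
    term n = trans (*ˢ-cong (pointwise (factor-coeff x n d)) (refl {partialSum xs n}))
                   (pointwise (λ i → P.sym (⊛-coeff (weight (kind x) (n ℕ.+ d)) (partialSum xs n) i)))

  private
    support-< : ∀ (b : Vector) d y → y < suc d → (∀ n → n < d → b n ≈ 0#) → ∀ n → b n * 𝟙[ n ℕP.<? y ] ≈ 0#
    support-< b d y y<1+d b≈0 n with n ℕP.<? y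
    ... | yes n<y = trans (*-cong (b≈0 n (ℕP.<-≤-trans n<y (ℕP.≤-pred y<1+d))) refl) (zeroˡ _)
    ... | no  _   = zeroʳ _

    support-≤ : ∀ (b : Vector) d y W → y < d → (∀ n → n < d → b n ≈ 0#) → ∀ n → b n * (𝟙[ n ℕP.≤? y ] * W) ≈ 0#
    support-≤ b d y W y<d b≈0 n with n ℕP.≤? y
    ... | yes n≤y = trans (*-cong (b≈0 n (ℕP.≤-<-trans n≤y y<d)) refl) (zeroˡ _)
    ... | no  _   = trans (*-cong refl (zeroˡ W)) (zeroʳ _)

  β-support : ∀ v y → y < dCount v → β v y ≈ 0#
  β-support (eAB ∷ xs) y y<d = Σ-zero L (λ n _ → support-< (β xs) (dCount xs) y y<d (β-support xs) n)
  β-support (eAC ∷ xs) y y<d = Σ-zero L (λ n _ → support-< (β xs) (dCount xs) y y<d (β-support xs) n)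
  β-support (eBC ∷ xs) y y<d = Σ-zero L (λ n _ → zeroʳ _)
  β-support (eBD ∷ xs) y y<d = Σ-zero L (λ n _ → support-≤ (β xs) (dCount xs) y (Pq y) y<d (β-support xs) n)
  β-support (eCD ∷ xs) y y<d = Σ-zero L (λ n _ → support-≤ (β xs) (dCount xs) y (Pq y) y<d (β-support xs) n)
  β-support (eAD ∷ xs) y y<d = Σ-zero L (λ n _ → support-≤ (β xs) (dCount xs) y (Dq y) y<d (β-support xs) n)

  private
    strict-level : ∀ xs n → Σ≤ L (λ j → β xs j * 𝟙[ j ℕP.<? suc (dCount xs ℕ.+ n) ]) ≈
                   1# * Σ≤ L (λ j → 𝟙[ j ℕP.≤? n ℕ.+ dCount xs ] * β xs j)
    strict-level xs n = trans (Σ-cong L (λ j _ → trans (*-comm _ _) (*-cong (𝟙-⇔ (j ℕP.<? suc (dCount xs ℕ.+ n)) (j ℕP.≤? n ℕ.+ dCount xs)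
                          (λ j<1+d+n → P.subst (j ≤_) (ℕP.+-comm (dCount xs) n) (ℕP.≤-pred j<1+d+n))
                          (λ j≤n+d → s≤s (P.subst (j ≤_) (ℕP.+-comm n (dCount xs)) j≤n+d))) refl)))
                        (sym (*-identityˡ _))

    weighted-level : ∀ (b : Vector) t W → Σ≤ L (λ j → b j * (𝟙[ j ℕP.≤? t ] * W)) ≈ W * Σ≤ L (λ j → 𝟙[ j ℕP.≤? t ] * b j)
    weighted-level b t W = trans (Σ-cong L (λ j _ → solve 3 (λ x i w → x :* (i :* w) := w :* (i :* x)) refl (b j) 𝟙[ j ℕP.≤? t ] W))
                                 (sym (*-distribˡ-Σ L W _))

  β-level : ∀ x xs n → β (x ∷ xs) (dCount (x ∷ xs) ℕ.+ n) ≈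
            weight (kind x) (n ℕ.+ dCount (x ∷ xs)) * Σ≤ L (λ j → 𝟙[ j ℕP.≤? n ℕ.+ dCount xs ] * β xs j)
  β-level eAB xs n = strict-level xs n
  β-level eAC xs n = strict-level xs n
  β-level eBC xs n = trans (Σ-zero L (λ j _ → zeroʳ _)) (sym (zeroˡ _))
  β-level eBD xs n rewrite ℕP.+-comm (dCount xs) n = weighted-level (β xs) (n ℕ.+ dCount xs) (Pq (n ℕ.+ dCount xs))
  β-level eCD xs n rewrite ℕP.+-comm (dCount xs) n = weighted-level (β xs) (n ℕ.+ dCount xs) (Pq (n ℕ.+ dCount xs))
  β-level eAD xs n rewrite ℕP.+-comm (dCount xs) n = weighted-level (β xs) (n ℕ.+ dCount xs) (Dq (n ℕ.+ dCount xs))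

  partialSum≈Σβ : ∀ v M → M ℕ.+ dCount v ≤ L → partialSum v M ≈ Σ≤ L (λ y → 𝟙[ y ℕP.≤? M ℕ.+ dCount v ] * β v y)
  partialSum≈Σβ [] M _ = sym (trans (Σ-single L 0 z≤n off) (trans (*-cong (𝟙-yes (0 ℕP.≤? M ℕ.+ 0) z≤n) refl) (*-identityˡ _)))
    where
    off : ∀ y → y ≤ L → y ≢ 0 → 𝟙[ y ℕP.≤? M ℕ.+ 0 ] * e₀ y ≈ 0#
    off y _ y≢0 = trans (*-cong refl (𝟙-no (y ℕP.≟ 0) y≢0)) (zeroʳ _)
  partialSum≈Σβ (x ∷ xs) M M+d≤L = begin
    partialSum (x ∷ xs) M
      ≈⟨ partialSum-cons x xs M ⟩
    Σ≤ M (λ n → weight (kind x) (n ℕ.+ d) * partialSum xs n)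
      ≈⟨ Σ-cong M (λ n n≤M → *-cong refl (partialSum≈Σβ xs n (ℕP.≤-trans (ℕP.+-mono-≤ n≤M (ℕP.m≤n+m (dCount xs) (isABC x))) M+d≤L))) ⟩
    Σ≤ M (λ n → weight (kind x) (n ℕ.+ d) * Σ≤ L (λ j → 𝟙[ j ℕP.≤? n ℕ.+ dCount xs ] * β xs j))
      ≈⟨ Σ-cong M (λ n _ → β-level x xs n) ⟨
    Σ≤ M (λ n → β (x ∷ xs) (d ℕ.+ n))
      ≈⟨ Σ-shift d M (β (x ∷ xs)) ⟩
    Σ≤ (d ℕ.+ M) (λ y → 𝟙[ d ℕP.≤? y ] * β (x ∷ xs) y)
      ≈⟨ Σ-cong (d ℕ.+ M) (λ y y≤d+M → trans (drop-support y) (sym (keep y y≤d+M))) ⟩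
    Σ≤ (d ℕ.+ M) (λ y → 𝟙[ y ℕP.≤? M ℕ.+ d ] * β (x ∷ xs) y)
      ≈⟨ Σ-truncate L (d ℕ.+ M) (P.subst (_≤ L) (ℕP.+-comm M d) M+d≤L) (λ y d+M<y _ → cut y d+M<y) ⟨
    Σ≤ L (λ y → 𝟙[ y ℕP.≤? M ℕ.+ d ] * β (x ∷ xs) y) ∎
    where
    d = dCount (x ∷ xs)
    drop-support : ∀ y → 𝟙[ d ℕP.≤? y ] * β (x ∷ xs) y ≈ β (x ∷ xs) y
    drop-support y with d ℕP.≤? y
    ... | yes _   = *-identityˡ _
    ... | no  d≰y = trans (zeroˡ _) (sym (β-support (x ∷ xs) y (ℕP.≰⇒> d≰y)))
    keep : ∀ y → y ≤ d ℕ.+ M → 𝟙[ y ℕP.≤? M ℕ.+ d ] * β (x ∷ xs) y ≈ β (x ∷ xs) y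
    keep y y≤d+M = trans (*-cong (𝟙-yes (y ℕP.≤? M ℕ.+ d) (P.subst (y ≤_) (ℕP.+-comm d M) y≤d+M)) refl) (*-identityˡ _)
    cut : ∀ y → d ℕ.+ M < y → 𝟙[ y ℕP.≤? M ℕ.+ d ] * β (x ∷ xs) y ≈ 0#
    cut y d+M<y = trans (*-cong (𝟙-no (y ℕP.≤? M ℕ.+ d) (ℕP.<⇒≱ (P.subst (ℕ._< y) (ℕP.+-comm d M) d+M<y))) refl) (zeroˡ _)

  private
    Pq-term-vanish : ∀ x xs → kind x ≡ κP → ∀ n → L < n ℕ.+ dCount (x ∷ xs) →
                     weight (kind x) (n ℕ.+ dCount (x ∷ xs)) * partialSum xs n ≈ 0#
    Pq-term-vanish x xs κ≡κP n L<n+d rewrite κ≡κP = trans (*-cong (Pq-vanish _ L<n+d) refl) (zeroˡ _)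

    Pq-first : ∀ x xs → kind x ≡ κP → ∀ M → L ≤ M → partialSum (x ∷ xs) M ≈ Σ≤ L (β (x ∷ xs))
    Pq-first x xs κ≡κP M L≤M with dCount (x ∷ xs) ℕP.≤? L
    ... | yes d≤L = begin
      partialSum (x ∷ xs) M
        ≈⟨ partialSum-cons x xs M ⟩
      Σ≤ M (λ n → weight (kind x) (n ℕ.+ d) * partialSum xs n)
        ≈⟨ Σ-truncate M (L ∸ d) (ℕP.≤-trans (ℕP.m∸n≤m L d) L≤M)
             (λ n L∸d<n _ → Pq-term-vanish x xs κ≡κP n (P.subst (ℕ._< n ℕ.+ d) (ℕP.m∸n+n≡m d≤L) (ℕP.+-monoˡ-< d L∸d<n))) ⟩
      Σ≤ (L ∸ d) (λ n → weight (kind x) (n ℕ.+ d) * partialSum xs n)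
        ≈⟨ partialSum-cons x xs (L ∸ d) ⟨
      partialSum (x ∷ xs) (L ∸ d)
        ≈⟨ partialSum≈Σβ (x ∷ xs) (L ∸ d) (ℕP.≤-reflexive (ℕP.m∸n+n≡m d≤L)) ⟩
      Σ≤ L (λ y → 𝟙[ y ℕP.≤? L ∸ d ℕ.+ d ] * β (x ∷ xs) y)
        ≈⟨ Σ-cong L (λ y y≤L → trans (*-cong (𝟙-yes (y ℕP.≤? L ∸ d ℕ.+ d) (P.subst (y ≤_) (P.sym (ℕP.m∸n+n≡m d≤L)) y≤L)) refl) (*-identityˡ _)) ⟩
      Σ≤ L (β (x ∷ xs)) ∎
      where d = dCount (x ∷ xs)
    ... | no d≰L = trans (partialSum-cons x xs M)
      (trans (Σ-zero M (λ n _ → Pq-term-vanish x xs κ≡κP n (ℕP.<-≤-trans (ℕP.≰⇒> d≰L) (ℕP.m≤n+m _ n))))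
             (sym (Σ-zero L (λ y y≤L → β-support (x ∷ xs) y (ℕP.≤-<-trans y≤L (ℕP.≰⇒> d≰L))))))

  -- The first letter of an admissible word carries the factor Pq (or 0), which kills every term with n₁ + d₁ > L.
  partialSum-stable : ∀ w → FirstOK w → ∀ M → L ≤ M → partialSum w M ≈ Σ≤ L (β w)
  partialSum-stable [] _ M _ = sym (Σ-single L 0 z≤n (λ y _ y≢0 → 𝟙-no (y ℕP.≟ 0) y≢0))
  partialSum-stable (eAB ∷ xs) bad = ⊥-elim (bad tt)
  partialSum-stable (eAC ∷ xs) bad = ⊥-elim (bad tt)
  partialSum-stable (eAD ∷ xs) bad = ⊥-elim (bad tt)
  partialSum-stable (eBC ∷ xs) _ M _ = trans (partialSum-cons eBC xs M)
    (trans (Σ-zero M (λ n _ → zeroˡ _)) (sym (Σ-zero L (λ y _ → Σ-zero L (λ n _ → zeroʳ _)))))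
  partialSum-stable (eBD ∷ xs) _ = Pq-first eBD xs P.refl
  partialSum-stable (eCD ∷ xs) _ = Pq-first eCD xs P.refl

  duality : ∀ w → Admissible w → ∀ M → L ≤ M → partialSum w M ≈ partialSum (τ w) M
  duality w adm M L≤M = begin
    partialSum w M       ≈⟨ partialSum-stable w (proj₁ adm) M L≤M ⟩
    Σ≤ L (β w)           ≈⟨ Σβ≈Σβ∘τ w adm ⟩
    Σ≤ L (β (τ w))       ≈⟨ partialSum-stable (τ w) (FirstOK-τ w (proj₂ adm)) M L≤M ⟨
    partialSum (τ w) M   ∎

coefficient-stable : ∀ w → FirstOK w → ∀ i M → i ≤ M → partialSum w M i ≡ partialSum w i i
coefficient-stable w ok i M i≤M =
  coeff (trans (partialSum-stable w ok M i≤M) (sym (partialSum-stable w ok i ℕP.≤-refl))) i ℕP.≤-refl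
  where open PartialSums i using (partialSum-stable; trans; sym)

coefficient-dual : ∀ w → Admissible w → ∀ i M → i ≤ M → partialSum (τ w) M i ≡ partialSum w M i
coefficient-dual w adm i M i≤M = P.sym (coeff (PartialSums.duality i w adm M i≤M) i ℕP.≤-refl)

theorem4p7 : (w : Word) → Admissible w → ∃ λ S → SumsTo w S × SumsTo (τ w) S
theorem4p7 w adm = S , w→S , τw→S
  where
  S : Series
  S i = partialSum w i i
  w→S : SumsTo w S
  w→S N = N , λ M N≤M i i≤N → coefficient-stable w (proj₁ adm) i M (ℕP.≤-trans i≤N N≤M)
  τw→S : SumsTo (τ w) S
  τw→S N = N , λ M N≤M i i≤N → P.trans (coefficient-dual w adm i M (ℕP.≤-trans i≤N N≤M)) (proj₂ (w→S N) M N≤M i i≤N)
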